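{- Let $\Phi$ be a finite reduced crystallographic root system with positive roots $\Phi^+$, simple roots $\alpha_1,\dots,\alpha_r$, $S=\{1,\dots,r\}$. For $j\in S$, let $c_{\{j\}}=\sum_{k\in S}h_k(\{j\})\alpha_k$ denote (the root combination associated with) the unique final configuration of the modified Kostant game on $I=\{j\}$. Then $$\sum_{\alpha\in\Phi^+}\alpha=\sum_{j\in S}c_{\{j\}}=\sum_{k\in S}\Big(\sum_{j\in S}h_k(\{j\})\Big)\alpha_k.$$
   Context: $\alpha^\vee=2\alpha/(\alpha,\alpha)$, $\langle x,\alpha^\vee\rangle=2(x,\alpha)/(\alpha,\alpha)$. Modified Kostant game on $I\subseteq S$: configurations are integer vectors $c=(c_1,\dots,c_r)$, identified with $\sum_k c_k\alpha_k$, initially $0$; for $u\neq v$, $n_{v,u}=-\langle\alpha_u,\alpha_v^\vee\rangle$. Vertex $v$ is sad in $c$ if $c_v<\frac12(\sum_{u\neq v}n_{v,u}c_u+[v\in I])$ ($[v\in I]$ is $1$ if $v\in I$, else $0$); a move at a sad vertex $v$ replaces $c_v$ by $-c_v+\sum_{u\neq v}n_{v,u}c_u+[v\in I]$, other coordinates unchanged. Moves are made only at sad vertices until no vertex is sad; the resulting final configuration is unique (independent of the play).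
   Formalization: The ambient Euclidean space of Φ is taken over the rationals, with an inner product taking rational values on the simple roots $\alpha_1,\dots,\alpha_r$. -}

module Defs where

open import Data.Nat using (ℕ; zero; suc)
open import Data.Fin using (Fin; zero; suc; _≟_)
open import Data.Fin.Subset using (Subset)
open import Data.Bool using (Bool; true; false; if_then_else_)
open import Data.Integer as ℤ using (ℤ; +_; 0ℤ; 1ℤ)
open import Data.Rational as ℚ using (ℚ; 0ℚ; 1ℚ)
open import Data.Vec using (Vec; lookup; replicate; _[_]≔_; tabulate; map; zipWith)
import Data.Vec.Relation.Unary.All as VAll
open import Data.List as List using (List; filter; foldr)
open import Data.List.Membership.Propositional using (_∈_)
open import Data.List.Relation.Unary.Unique.Propositional using (Unique)
open import Data.List.Relation.Unary.All using (All)
open import Relation.Binary.PropositionalEquality using (_≡_; _≢_)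
open import Relation.Binary.Construct.Closure.ReflexiveTransitive using (Star)
open import Data.Product using (∃; _×_)
open import Data.Sum using (_⊎_)
open import Relation.Nullary using (¬_; does)

Σℤ : ∀ {n} → (Fin n → ℤ) → ℤ
Σℤ {zero}  f = 0ℤ
Σℤ {suc n} f = f zero ℤ.+ Σℤ (λ i → f (suc i))

Σℚ : ∀ {n} → (Fin n → ℚ) → ℚ
Σℚ {zero}  f = 0ℚ
Σℚ {suc n} f = f zero ℚ.+ Σℚ (λ i → f (suc i))

toℚ : ℤ → ℚ
toℚ z = z ℚ./ 1

vq : ∀ {r} → Vec ℤ r → Fin r → ℚ
vq v i = toℚ (lookup v i)

-- the inner product (x,y) = Σ_{i,j} x_i (α_i,α_j) y_j, with B i j = (α_i,α_j)
form : ∀ {r} → (Fin r → Fin r → ℚ) → (Fin r → ℚ) → (Fin r → ℚ) → ℚ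
form B x y = Σℚ λ i → Σℚ λ j → x i ℚ.* B i j ℚ.* y j

simple : ∀ {r} → Fin r → Vec ℤ r
simple k = tabulate λ i → if does (i ≟ k) then 1ℤ else 0ℤ

_-[_]·_ : ∀ {r} → Vec ℤ r → ℤ → Vec ℤ r → Vec ℤ r
β -[ n ]· α = zipWith (λ b a → b ℤ.- n ℤ.* a) β α

two : ℚ
two = toℚ (+ 2)

-- A finite reduced crystallographic root system Φ in a rational Euclidean space
-- V = ℚ^r (inner product with Gram matrix B w.r.t. the basis α_1..α_r),
-- together with its base Δ = {α_1,..,α_r}; roots are recorded by their
-- coordinates in the simple roots.
-- ⟨β,α^∨⟩ = n  is written as  2(β,α) = n (α,α)  (legitimate since (α,α) > 0).
record RootSystem : Set where
  field
    r        : ℕ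
    B        : Fin r → Fin r → ℚ
    B-sym    : ∀ i j → B i j ≡ B j i
    B-posdef : ∀ (x : Fin r → ℚ) → (∃ λ i → x i ≢ 0ℚ) → 0ℚ ℚ.< form B x x
    roots        : List (Vec ℤ r)
    roots-unique : Unique roots
    roots-nonzero : All (λ α → ∃ λ i → lookup α i ≢ 0ℤ) roots
    reduced : ∀ {α β} → α ∈ roots → β ∈ roots → (c : ℚ) →
              (∀ i → vq β i ≡ c ℚ.* vq α i) → c ≡ 1ℚ ⊎ c ≡ ℚ.- 1ℚ
    crystallographic : ∀ {α β} → α ∈ roots → β ∈ roots →
              ∃ λ (n : ℤ) → two ℚ.* form B (vq β) (vq α) ≡ toℚ n ℚ.* form B (vq α) (vq α)
    reflection : ∀ {α β} → α ∈ roots → β ∈ roots → (n : ℤ) →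
              two ℚ.* form B (vq β) (vq α) ≡ toℚ n ℚ.* form B (vq α) (vq α) →
              (β -[ n ]· α) ∈ roots
    simple∈ : ∀ k → simple k ∈ roots
    base    : All (λ α → (∀ i → 0ℤ ℤ.≤ lookup α i) ⊎ (∀ i → lookup α i ℤ.≤ 0ℤ)) roots
    -- Cartan integers: cartan u v = ⟨α_u,α_v^∨⟩
    cartan      : Fin r → Fin r → ℤ
    cartan-spec : ∀ u v → two ℚ.* B u v ≡ toℚ (cartan u v) ℚ.* B v v

module _ (R : RootSystem) where
  open RootSystem R

  positiveRoots : List (Vec ℤ r)
  positiveRoots = filter (VAll.all? (λ z → 0ℤ ℤ.≤? z)) roots

  sumPositive : Fin r → ℤ
  sumPositive k = foldr (λ α s → lookup α k ℤ.+ s) 0ℤ positiveRoots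

  Config : Set
  Config = Vec ℤ r

  nn : Fin r → Fin r → ℤ
  nn v u = ℤ.- cartan u v

  indicator : Subset r → Fin r → ℤ
  indicator I v = if lookup I v then 1ℤ else 0ℤ

  nbr : Config → Fin r → ℤ
  nbr c v = Σℤ λ u → if does (u ≟ v) then 0ℤ else nn v u ℤ.* lookup c u

  -- v sad:  c_v < ½ (Σ_{u≠v} n_{v,u} c_u + [v∈I])   (multiplied by 2)
  Sad : Subset r → Config → Fin r → Set
  Sad I c v = + 2 ℤ.* lookup c v ℤ.< nbr c v ℤ.+ indicator I v

  Move : Subset r → Config → Config → Set
  Move I c c' = ∃ λ v → Sad I c v ×
                 c' ≡ c [ v ]≔ (ℤ.- lookup c v ℤ.+ nbr c v ℤ.+ indicator I v)

  FinalConfig : Subset r → Config → Set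
  FinalConfig I c = Star (Move I) (replicate r 0ℤ) c × (∀ v → ¬ Sad I c v)

-- Let ϖ be the weight with 2 (ϖ, α_i) = δ i j (α_j, α_j).  A move at v replaces c by c - ⟨c - ϖ, α_v^∨⟩ α_v,
-- i.e. it reflects c - ϖ in α_v, and v is sad exactly when ⟨c - ϖ, α_v^∨⟩ < 0.  So the final configuration
-- is ϖ + μ with μ a dominant element of the Weyl orbit of -ϖ.  That orbit contains the dominant weight -w₀ ϖ,
-- where the word w₀ sends each simple root α_v to a negative simple root -α_{σ v}, and a dominant weight is the
-- only dominant element of its orbit; hence ⟨c_{j}, α_v^∨⟩ = δ v j + δ j (σ v).  Summing over j, every pairing
-- ⟨Σ_j c_{j}, α_v^∨⟩ equals 2, and so does ⟨Σ Φ⁺, α_v^∨⟩ because s_v permutes Φ⁺ ∖ {α_v}; as the form is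
-- nondegenerate the two vectors coincide.  The word w₀ is found by appending reflections s_v with w α_v > 0,
-- each of which lowers the number of positive roots that w keeps positive.

module Submission where

open import Algebra.Bundles using (CommutativeRing)
open import Data.Bool using (true; false; if_then_else_)
open import Data.Fin as F using (Fin; zero; suc)
open import Data.Nat as ℕ using (ℕ)
open import Data.Vec.Functional using (Vector)
open import Function using (_∘_; id)
import Relation.Binary.PropositionalEquality as ≡
open ≡ using (_≡_; _≢_)
open import Relation.Nullary using (Dec; does; yes; no; ¬_; contradiction)

module FiniteSum {c ℓ} (R : CommutativeRing c ℓ) where
  open CommutativeRing R hiding (zero)
  open import Algebra.Properties.Semiring.Sum semiring public
  open import Algebra.Properties.Ring ring using (-‿distribˡ-*)
  open import Relation.Binary.Reasoning.Setoid setoid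

  δ : ∀ {n} → Fin n → Fin n → Carrier
  δ i j = if does (i F.≟ j) then 1# else 0#

  ∑-zero : ∀ {n} (f : Vector Carrier n) → (∀ i → f i ≈ 0#) → sum f ≈ 0#
  ∑-zero {n} f f≈0 = trans (sum-cong-≋ f≈0) (sum-replicate-zero n)

  ∑-*-δ : ∀ {n} (f : Vector Carrier n) v → ∑[ i < n ] (f i * δ i v) ≈ f v
  ∑-*-δ {ℕ.suc n} f zero = begin
    f zero * 1# + ∑[ i < n ] (f (suc i) * 0#)
      ≈⟨ +-cong (*-identityʳ _) (∑-zero (λ i → f (suc i) * 0#) (λ i → zeroʳ _)) ⟩
    f zero + 0#
      ≈⟨ +-identityʳ _ ⟩
    f zero ∎
  ∑-*-δ {ℕ.suc n} f (suc v) = begin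
    f zero * 0# + ∑[ i < n ] (f (suc i) * δ i v)  ≈⟨ +-cong (zeroʳ _) (∑-*-δ (f ∘ suc) v) ⟩
    0# + f (suc v)                                ≈⟨ +-identityˡ _ ⟩
    f (suc v)                                     ∎

  ∑-δ-* : ∀ {n} (f : Vector Carrier n) v → ∑[ i < n ] (δ i v * f i) ≈ f v
  ∑-δ-* f v = trans (sum-cong-≋ (λ i → *-comm (δ i v) (f i))) (∑-*-δ f v)

  ∑-δ : ∀ {n} (v : Fin n) → ∑[ i < n ] δ i v ≈ 1#
  ∑-δ v = trans (sum-cong-≋ {x = λ i → δ i v} (λ i → sym (*-identityˡ _))) (∑-*-δ (λ _ → 1#) v)

  ∑-sub-* : ∀ {n} (f g : Vector Carrier n) q →
            ∑[ i < n ] (f i - q * g i) ≈ sum f - q * sum g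
  ∑-sub-* f g q = begin
    sum (λ i → f i - q * g i)         ≈⟨ ∑-distrib-+ f (λ i → - (q * g i)) ⟩
    sum f + sum (λ i → - (q * g i))   ≈⟨ +-congˡ (sum-cong-≋ (λ i → -‿distribˡ-* q (g i))) ⟩
    sum f + sum (λ i → - q * g i)     ≈⟨ +-congˡ (sym (*-distribˡ-sum (- q) g)) ⟩
    sum f + - q * sum g               ≈⟨ +-congˡ (sym (-‿distribˡ-* q (sum g))) ⟩
    sum f - q * sum g                 ∎

  δ-refl : ∀ {n} (v : Fin n) → δ v v ≡ 1#
  δ-refl zero    = ≡.refl
  δ-refl (suc v) = δ-refl v

  δ-≢ : ∀ {n} {i j : Fin n} → i ≢ j → δ i j ≡ 0#
  δ-≢ {i = i} {j} i≢j with i F.≟ j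
  ... | yes i≡j = contradiction i≡j i≢j
  ... | no _    = ≡.refl

  δ-* : ∀ {n} (f : Vector Carrier n) i j → δ i j * f i ≈ δ i j * f j
  δ-* f i j = by-cases (i F.≟ j)
    where
    by-cases : (i≟j : Dec (i ≡ j)) → (if does i≟j then 1# else 0#) * f i ≈ (if does i≟j then 1# else 0#) * f j
    by-cases (yes ≡.refl) = refl
    by-cases (no _)       = trans (zeroˡ (f i)) (sym (zeroˡ (f j)))

  δ-sym : ∀ {n} (i j : Fin n) → δ i j ≡ δ j i
  δ-sym zero    zero    = ≡.refl
  δ-sym zero    (suc j) = ≡.refl
  δ-sym (suc i) zero    = ≡.refl
  δ-sym (suc i) (suc j) = δ-sym i j

-- Imported only here: FiniteSum opens ring operations whose names clash with those of ℤ and _≡_.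
open import Defs
open import Data.Fin.Subset using (⁅_⁆)
import Data.Fin.Properties as FP
open import Data.Integer as ℤ using (ℤ; +_; -[1+_]; 0ℤ; 1ℤ; _+_; _*_; -_; _-_; _≤_)
import Data.Integer.Properties as ℤP
open import Data.Integer.Tactic.RingSolver using (solve-∀)
open import Data.List using (List; []; _∷_; _++_; reverse; _∷ʳ_; length; map; filter; foldr)
import Data.List.Properties as LP
open import Data.List.Membership.Propositional using (_∈_)
import Data.List.Membership.Propositional.Properties as MP
open import Data.List.Membership.Propositional.Properties.WithK using (unique∧set⇒bag)
open import Data.List.Relation.Binary.BagAndSetEquality using (∼bag⇒↭)
open import Data.List.Relation.Binary.Permutation.Propositional using (_↭_; ↭⇒↭ₛ)
import Data.List.Relation.Binary.Permutation.Propositional.Properties as PermP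
import Data.List.Relation.Binary.Permutation.Setoid.Properties (≡.setoid ℤ) as PermS
import Data.List.Relation.Unary.All as LAll
open import Data.List.Relation.Unary.AllPairs using (_∷_)
open import Data.List.Relation.Unary.Any using (here; there)
open import Data.List.Relation.Unary.Unique.Propositional using (Unique)
import Data.List.Relation.Unary.Unique.Propositional.Properties as UP
open import Data.List.Reverse using (Reverse; reverseView; []; _∶_∶ʳ_)
import Data.Nat.Coprimality as Cop
import Data.Nat.Induction as ℕI
import Data.Nat.Properties as ℕP
open import Data.Product using (∃; _×_; _,_; proj₁; proj₂)
open import Data.Rational as ℚ using (ℚ; 0ℚ; 1ℚ; mkℚ)
import Data.Rational.Properties as ℚP
open import Data.Rational.Solver using (module +-*-Solver)
open import Data.Sum using (_⊎_; inj₁; inj₂; [_,_]′)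
open import Data.Vec using (Vec; lookup; tabulate; replicate; _[_]≔_)
import Data.Vec.Properties as VP
import Data.Vec.Relation.Unary.All as VAll
import Data.Vec.Relation.Unary.All.Properties as VAllP
open import Function.Bundles using (mk⇔)
open import Induction.WellFounded using (Acc; acc)
open import Relation.Binary.Construct.Closure.ReflexiveTransitive using (Star; ε; _◅_)
open import Relation.Nullary.Decidable using (decidable-stable)
open ≡
open ≡-Reasoning
open +-*-Solver using (solve; _:+_; _:*_; :-_; _:-_; _:=_)
open import Algebra.Properties.Ring ℚP.+-*-ring using (-‿involutive)

module ℤΣ = FiniteSum ℤP.+-*-commutativeRing
module ℚΣ = FiniteSum ℚP.+-*-commutativeRing

open ℤΣ using (sum; δ)

∑-mono-≤ : ∀ {n} {f g : Vector ℤ n} → (∀ i → f i ≤ g i) → sum f ≤ sum g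
∑-mono-≤ {ℕ.zero}  f≤g = ℤP.≤-refl
∑-mono-≤ {ℕ.suc n} f≤g = ℤP.+-mono-≤ (f≤g zero) (∑-mono-≤ (f≤g ∘ suc))

∑-nonneg : ∀ {n} {f : Vector ℤ n} → (∀ i → 0ℤ ≤ f i) → 0ℤ ≤ sum f
∑-nonneg {n} 0≤f =
  ℤP.≤-trans (ℤP.≤-reflexive (sym (ℤΣ.sum-replicate-zero n))) (∑-mono-≤ {f = λ _ → 0ℤ} 0≤f)

∑-nonpos : ∀ {n} {f : Vector ℤ n} → (∀ i → f i ≤ 0ℤ) → sum f ≤ 0ℤ
∑-nonpos {n} f≤0 = ℤP.≤-trans (∑-mono-≤ {g = λ _ → 0ℤ} f≤0) (ℤP.≤-reflexive (ℤΣ.sum-replicate-zero n))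

term≤∑ : ∀ {n} {f : Vector ℤ n} → (∀ i → 0ℤ ≤ f i) → ∀ k → f k ≤ sum f
term≤∑ {f = f} 0≤f zero    = ℤP.i≤i+j (f zero) _ {{ℤ.nonNegative (∑-nonneg (0≤f ∘ suc))}}
term≤∑ {f = f} 0≤f (suc k) =
  ℤP.≤-trans (term≤∑ (0≤f ∘ suc) k) (ℤP.i≤j+i _ (f zero) {{ℤ.nonNegative (0≤f zero)}})

∑≤term : ∀ {n} {f : Vector ℤ n} → (∀ i → f i ≤ 0ℤ) → ∀ k → sum f ≤ f k
∑≤term {f = f} f≤0 zero    =
  ℤP.≤-trans (ℤP.+-monoʳ-≤ (f zero) (∑-nonpos (f≤0 ∘ suc))) (ℤP.≤-reflexive (ℤP.+-identityʳ (f zero)))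
∑≤term {f = f} f≤0 (suc k) =
  ℤP.≤-trans (ℤP.+-mono-≤ (f≤0 zero) (∑≤term (f≤0 ∘ suc) k))
             (ℤP.≤-reflexive (ℤP.+-identityˡ (f (suc k))))

0≤i∧1≤j⇒i≤i*j : ∀ {i j} → 0ℤ ≤ i → 1ℤ ≤ j → i ≤ i * j
0≤i∧1≤j⇒i≤i*j {i} {j} 0≤i 1≤j =
  subst (_≤ i * j) (ℤP.*-identityʳ i) (ℤP.*-monoˡ-≤-nonNeg i {{ℤ.nonNegative 0≤i}} 1≤j)

x≡-x⇒x≡0 : ∀ {x} → x ≡ - x → x ≡ 0ℤ
x≡-x⇒x≡0 {+ 0} _ = refl

0≤i≢0⇒1≤i : ∀ {i} → 0ℤ ≤ i → i ≢ 0ℤ → 1ℤ ≤ i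
0≤i≢0⇒1≤i {+ 0}       _ i≢0 = contradiction refl i≢0
0≤i≢0⇒1≤i {+ ℕ.suc _} _ _   = ℤ.+≤+ (ℕ.s≤s ℕ.z≤n)

*-nonneg-nonpos : ∀ {i j} → 0ℤ ≤ i → j ≤ 0ℤ → i * j ≤ 0ℤ
*-nonneg-nonpos {i} 0≤i j≤0 =
  subst (i * _ ≤_) (ℤP.*-zeroʳ i) (ℤP.*-monoˡ-≤-nonNeg i {{ℤ.nonNegative 0≤i}} j≤0)

nonpos≢0⇒≤-1 : ∀ {i} → i ≤ 0ℤ → i ≢ 0ℤ → i ≤ -[1+ 0 ]
nonpos≢0⇒≤-1 {+ 0}      _ i≢0 = contradiction refl i≢0
nonpos≢0⇒≤-1 { -[1+ _ ]} _ _   = ℤ.-≤- ℕ.z≤n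
nonpos≢0⇒≤-1 {+ ℕ.suc _} (ℤ.+≤+ ()) _

i+j≡1⇒i≡1∧j≡0 : ∀ {i j} → 1ℤ ≤ i → 0ℤ ≤ j → i + j ≡ 1ℤ → i ≡ 1ℤ × j ≡ 0ℤ
i+j≡1⇒i≡1∧j≡0 {+ 1}                 {+ 0}            _ _ _  = refl , refl
i+j≡1⇒i≡1∧j≡0 {+ 1}                 {+ ℕ.suc _}      _ _ ()
i+j≡1⇒i≡1∧j≡0 {+ ℕ.suc (ℕ.suc _)}   {+ _}            _ _ ()
i+j≡1⇒i≡1∧j≡0 {+ 0}                 (ℤ.+≤+ ()) _ _
i+j≡1⇒i≡1∧j≡0 {_}                   { -[1+ _ ]}      _ () _

∑-*≡1⇒δ : ∀ {n} (g h : Vector ℤ n) → (∀ i → 0ℤ ≤ g i) → (∀ i → 1ℤ ≤ h i) →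
          sum (λ i → g i * h i) ≡ 1ℤ → ∃ λ k → ∀ i → g i ≡ δ i k
∑-*≡1⇒δ {ℕ.suc n} g h 0≤g 1≤h ∑≡1 with g zero ℤ.≟ 0ℤ
... | yes g₀≡0 = suc k , λ { zero → g₀≡0 ; (suc i) → g≡δ i }
  where
  rest≡1 : sum (λ i → g (suc i) * h (suc i)) ≡ 1ℤ
  rest≡1 = trans (sym (ℤP.+-identityˡ _))
                 (trans (cong (λ t → t * h zero + sum (λ i → g (suc i) * h (suc i))) (sym g₀≡0)) ∑≡1)
  ih = ∑-*≡1⇒δ (g ∘ suc) (h ∘ suc) (0≤g ∘ suc) (1≤h ∘ suc) rest≡1
  k = proj₁ ih
  g≡δ = proj₂ ih
... | no g₀≢0 = zero , λ { zero → g₀≡1 ; (suc i) → gᵢ≡0 i }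
  where
  0≤gh : ∀ i → 0ℤ ≤ g (suc i) * h (suc i)
  0≤gh i = ℤP.≤-trans (0≤g (suc i)) (0≤i∧1≤j⇒i≤i*j (0≤g (suc i)) (1≤h (suc i)))
  1≤g₀ : 1ℤ ≤ g zero
  1≤g₀ = 0≤i≢0⇒1≤i (0≤g zero) g₀≢0
  split = i+j≡1⇒i≡1∧j≡0 (ℤP.≤-trans 1≤g₀ (0≤i∧1≤j⇒i≤i*j (0≤g zero) (1≤h zero))) (∑-nonneg 0≤gh)
                          ∑≡1
  g₀≡1 : g zero ≡ 1ℤ
  g₀≡1 = ℤP.≤-antisym (subst (g zero ≤_) (proj₁ split) (0≤i∧1≤j⇒i≤i*j (0≤g zero) (1≤h zero))) 1≤g₀
  gᵢ≡0 : ∀ i → g (suc i) ≡ 0ℤ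
  gᵢ≡0 i = ℤP.≤-antisym
    (ℤP.≤-trans (0≤i∧1≤j⇒i≤i*j (0≤g (suc i)) (1≤h (suc i)))
                (subst (g (suc i) * h (suc i) ≤_) (proj₂ split) (term≤∑ 0≤gh i)))
    (0≤g (suc i))

coprime-1 : ∀ n → Cop.Coprime n 1
coprime-1 n = Cop.sym (Cop.1-coprimeTo n)

toℚ≡mkℚ : ∀ z → toℚ z ≡ mkℚ z 0 (coprime-1 ℤ.∣ z ∣)
toℚ≡mkℚ (+ n)    = ℚP.normalize-coprime {n} {0} (coprime-1 n)
toℚ≡mkℚ -[1+ n ] = cong ℚ.-_ (ℚP.normalize-coprime {ℕ.suc n} {0} (coprime-1 (ℕ.suc n)))

toℚ-+ : ∀ a b → toℚ (a + b) ≡ toℚ a ℚ.+ toℚ b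
toℚ-+ a b rewrite toℚ≡mkℚ a | toℚ≡mkℚ b =
  cong (ℚ._/ 1) (sym (cong₂ _+_ (ℤP.*-identityʳ a) (ℤP.*-identityʳ b)))

toℚ-* : ∀ a b → toℚ (a * b) ≡ toℚ a ℚ.* toℚ b
toℚ-* a b rewrite toℚ≡mkℚ a | toℚ≡mkℚ b = refl

toℚ-neg : ∀ a → toℚ (- a) ≡ ℚ.- toℚ a
toℚ-neg a rewrite toℚ≡mkℚ a | toℚ≡mkℚ (- a) = mkℚ-neg a
  where
  mkℚ-neg : ∀ a → mkℚ (- a) 0 (coprime-1 ℤ.∣ - a ∣) ≡ ℚ.- mkℚ a 0 (coprime-1 ℤ.∣ a ∣)
  mkℚ-neg (+ 0)       = refl
  mkℚ-neg (+ ℕ.suc n) = refl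
  mkℚ-neg -[1+ n ]    = refl

toℚ-- : ∀ a b → toℚ (a - b) ≡ toℚ a ℚ.- toℚ b
toℚ-- a b = trans (toℚ-+ a (- b)) (cong (toℚ a ℚ.+_) (toℚ-neg b))

toℚ-injective : ∀ {a b} → toℚ a ≡ toℚ b → a ≡ b
toℚ-injective {a} {b} eq rewrite toℚ≡mkℚ a | toℚ≡mkℚ b = cong ℚ.↥_ eq

toℚ-mono-≤ : ∀ {a b} → a ≤ b → toℚ a ℚ.≤ toℚ b
toℚ-mono-≤ {a} {b} a≤b rewrite toℚ≡mkℚ a | toℚ≡mkℚ b =
  ℚ.*≤* (subst₂ _≤_ (sym (ℤP.*-identityʳ a)) (sym (ℤP.*-identityʳ b)) a≤b)

toℚ-∑ : ∀ {n} (f : Vector ℤ n) → toℚ (sum f) ≡ ℚΣ.sum (toℚ ∘ f)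
toℚ-∑ {ℕ.zero}  f = refl
toℚ-∑ {ℕ.suc n} f = trans (toℚ-+ (f zero) _) (cong (toℚ (f zero) ℚ.+_) (toℚ-∑ (f ∘ suc)))

toℚ-δ : ∀ {n} (i j : Fin n) → toℚ (δ i j) ≡ ℚΣ.δ i j
toℚ-δ i j with does (i F.≟ j)
... | true  = refl
... | false = refl

∑-nonnegℚ : ∀ {n} {f : Vector ℚ n} → (∀ i → 0ℚ ℚ.≤ f i) → 0ℚ ℚ.≤ ℚΣ.sum f
∑-nonnegℚ {ℕ.zero}  0≤f = ℚP.≤-refl
∑-nonnegℚ {ℕ.suc n} 0≤f = ℚP.+-mono-≤ (0≤f zero) (∑-nonnegℚ (0≤f ∘ suc))

*-nonneg : ∀ {p q} → 0ℚ ℚ.≤ p → 0ℚ ℚ.≤ q → 0ℚ ℚ.≤ p ℚ.* q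
*-nonneg {p} {q} 0≤p 0≤q = ℚP.nonNegative⁻¹ _
  {{ℚP.nonNeg*nonNeg⇒nonNeg p {{ℚ.nonNegative 0≤p}} q {{ℚ.nonNegative 0≤q}}}}

*-cancelʳ-pos : ∀ {p q b} → 0ℚ ℚ.< b → p ℚ.* b ≡ q ℚ.* b → p ≡ q
*-cancelʳ-pos {b = b} 0<b pb≡qb = ℚP.≤-antisym
  (ℚP.*-cancelʳ-≤-pos b {{ℚ.positive 0<b}} (ℚP.≤-reflexive pb≡qb))
  (ℚP.*-cancelʳ-≤-pos b {{ℚ.positive 0<b}} (ℚP.≤-reflexive (sym pb≡qb)))

*-cancelˡ-pos : ∀ {p q b} → 0ℚ ℚ.< b → b ℚ.* p ≡ b ℚ.* q → p ≡ q
*-cancelˡ-pos {p} {q} {b} 0<b bp≡bq = *-cancelʳ-pos 0<b (trans (ℚP.*-comm p b) (trans bp≡bq (ℚP.*-comm b q)))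

0<two : 0ℚ ℚ.< two
0<two = ℚ.*<* (ℤ.+<+ (ℕ.s≤s ℕ.z≤n))

Σℤ≡∑ : ∀ {n} (f : Fin n → ℤ) → Σℤ f ≡ sum f
Σℤ≡∑ {ℕ.zero}  f = refl
Σℤ≡∑ {ℕ.suc n} f = cong (λ t → f zero + t) (Σℤ≡∑ (f ∘ suc))

Σℚ≡∑ : ∀ {n} (f : Fin n → ℚ) → Σℚ f ≡ ℚΣ.sum f
Σℚ≡∑ {ℕ.zero}  f = refl
Σℚ≡∑ {ℕ.suc n} f = cong (f zero ℚ.+_) (Σℚ≡∑ (f ∘ suc))

lookup-ext : ∀ {a} {A : Set a} {n} {x y : Vec A n} → (∀ i → lookup x i ≡ lookup y i) → x ≡ y
lookup-ext {x = x} {y} x≗y =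
  trans (sym (VP.tabulate∘lookup x)) (trans (VP.tabulate-cong x≗y) (VP.tabulate∘lookup y))

sumₗ : List ℤ → ℤ
sumₗ = foldr _+_ 0ℤ

sumₗ-↭ : ∀ {xs ys} → xs ↭ ys → sumₗ xs ≡ sumₗ ys
sumₗ-↭ xs↭ys = PermS.foldr-commMonoid ℤP.+-0-isCommutativeMonoid (↭⇒↭ₛ xs↭ys)

sumₗ-neg : ∀ {a} {A : Set a} (g : A → ℤ) L → sumₗ (map (λ x → - g x) L) ≡ - sumₗ (map g L)
sumₗ-neg g []      = refl
sumₗ-neg g (x ∷ L) =
  trans (cong (λ t → - g x + t) (sumₗ-neg g L)) (sym (ℤP.neg-distrib-+ (g x) (sumₗ (map g L))))

length<∷ʳ : ∀ {a} {A : Set a} (xs : List A) x → length xs ℕ.< length (xs ∷ʳ x)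
length<∷ʳ xs x = subst (length xs ℕ.<_) (sym (LP.length-++ xs)) (ℕP.m<m+n (length xs) (ℕ.s≤s ℕ.z≤n))

descent : ∀ {a p} {W : Set a} {P : W → Set p} → (∀ w → Dec (P w)) → (μ : W → ℕ) →
          (∀ w → ¬ P w → ∃ λ w′ → μ w′ ℕ.< μ w) → W → ∃ P
descent {P = P} P? μ step w = go w (ℕI.<-wellFounded (μ w))
  where
  go : ∀ w → Acc ℕ._<_ (μ w) → ∃ P
  go w (acc rec) = decide (P? w)
    where
    decide : Dec (P w) → ∃ P
    decide (yes Pw) = w , Pw
    decide (no ¬Pw) = let (w′ , μw′<μw) = step w ¬Pw in go w′ (rec μw′<μw)

module CartanMatrix {r} (C : Fin r → Fin r → ℤ) (C-diag : ∀ v → C v v ≡ + 2) where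

  V : Set
  V = Vec ℤ r

  infixl 9 _!_
  _!_ : V → Fin r → ℤ
  _!_ = lookup

  _≟_ : (x y : V) → Dec (x ≡ y)
  _≟_ = VP.≡-dec ℤ._≟_

  α : Fin r → V
  α = simple

  α-! : ∀ v i → α v ! i ≡ δ i v
  α-! v i = VP.lookup∘tabulate _ i

  -[]·-! : ∀ x k y i → (x -[ k ]· y) ! i ≡ x ! i - k * y ! i
  -[]·-! x k y i = VP.lookup-zipWith _ i x y

  weigh : (Fin r → ℤ) → V → ℤ
  weigh f x = sum (λ k → x ! k * f k)

  weigh-sub : ∀ f x k y → weigh f (x -[ k ]· y) ≡ weigh f x - k * weigh f y
  weigh-sub f x k y = trans (ℤΣ.sum-cong-≗ term) (ℤΣ.∑-sub-* (λ u → x ! u * f u) (λ u → y ! u * f u) k)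
    where
    term : ∀ u → (x -[ k ]· y) ! u * f u ≡ x ! u * f u - k * (y ! u * f u)
    term u = trans (cong (_* f u) (-[]·-! x k y u)) (distrib (x ! u) k (y ! u) (f u))
      where distrib : ∀ a k b c → (a - k * b) * c ≡ a * c - k * (b * c)
            distrib = solve-∀

  weigh-α : ∀ f v → weigh f (α v) ≡ f v
  weigh-α f v = trans (ℤΣ.sum-cong-≗ (λ u → cong (_* f u) (α-! v u))) (ℤΣ.∑-δ-* f v)

  ht : V → ℤ
  ht = weigh (λ _ → 1ℤ)

  ⟨_,_∨⟩ : V → Fin r → ℤ
  ⟨ x , v ∨⟩ = weigh (λ u → C u v) x

  ⟨α,∨⟩ : ∀ u v → ⟨ α u , v ∨⟩ ≡ C u v
  ⟨α,∨⟩ u v = weigh-α (λ u → C u v) u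

  s : Fin r → V → V
  s v x = x -[ ⟨ x , v ∨⟩ ]· α v

  s-! : ∀ v x i → s v x ! i ≡ x ! i - ⟨ x , v ∨⟩ * δ i v
  s-! v x i = trans (-[]·-! x ⟨ x , v ∨⟩ (α v) i) (cong (λ t → x ! i - ⟨ x , v ∨⟩ * t) (α-! v i))

  s-!-≢ : ∀ v x {i} → i ≢ v → s v x ! i ≡ x ! i
  s-!-≢ v x {i} i≢v = trans (s-! v x i)
                            (trans (cong (λ t → x ! i - ⟨ x , v ∨⟩ * t) (ℤΣ.δ-≢ i≢v)) (vanish (x ! i) ⟨ x , v ∨⟩))
    where vanish : ∀ a b → a - b * 0ℤ ≡ a
          vanish = solve-∀

  ⟨s,∨⟩ : ∀ v x m → ⟨ s v x , m ∨⟩ ≡ ⟨ x , m ∨⟩ - ⟨ x , v ∨⟩ * C v m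
  ⟨s,∨⟩ v x m = trans (weigh-sub (λ u → C u m) x ⟨ x , v ∨⟩ (α v))
                      (cong (λ t → ⟨ x , m ∨⟩ - ⟨ x , v ∨⟩ * t) (⟨α,∨⟩ v m))

  ⟨s,∨⟩-self : ∀ v x → ⟨ s v x , v ∨⟩ ≡ - ⟨ x , v ∨⟩
  ⟨s,∨⟩-self v x = trans (⟨s,∨⟩ v x v)
                         (trans (cong (λ t → ⟨ x , v ∨⟩ - ⟨ x , v ∨⟩ * t) (C-diag v)) (twice ⟨ x , v ∨⟩))
    where twice : ∀ a → a - a * + 2 ≡ - a
          twice = solve-∀

  s-involutive : ∀ v x → s v (s v x) ≡ x
  s-involutive v x = lookup-ext λ i → begin
    s v (s v x) ! i
      ≡⟨ s-! v (s v x) i ⟩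
    s v x ! i - ⟨ s v x , v ∨⟩ * δ i v
      ≡⟨ cong₂ (λ p q → p - q * δ i v) (s-! v x i) (⟨s,∨⟩-self v x) ⟩
    x ! i - ⟨ x , v ∨⟩ * δ i v - (- ⟨ x , v ∨⟩) * δ i v
      ≡⟨ cancel (x ! i) ⟨ x , v ∨⟩ (δ i v) ⟩
    x ! i ∎
    where cancel : ∀ a b d → a - b * d - (- b) * d ≡ a
          cancel = solve-∀

  s-sub : ∀ v x k y → s v (x -[ k ]· y) ≡ s v x -[ k ]· s v y
  s-sub v x k y = lookup-ext λ i → begin
    s v (x -[ k ]· y) ! i
      ≡⟨ s-! v (x -[ k ]· y) i ⟩
    (x -[ k ]· y) ! i - ⟨ x -[ k ]· y , v ∨⟩ * δ i v
      ≡⟨ cong₂ (λ p q → p - q * δ i v) (-[]·-! x k y i) (weigh-sub (λ u → C u v) x k y) ⟩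
    (x ! i - k * y ! i) - (⟨ x , v ∨⟩ - k * ⟨ y , v ∨⟩) * δ i v
      ≡⟨ regroup (x ! i) k (y ! i) ⟨ x , v ∨⟩ ⟨ y , v ∨⟩ (δ i v) ⟩
    (x ! i - ⟨ x , v ∨⟩ * δ i v) - k * (y ! i - ⟨ y , v ∨⟩ * δ i v)
      ≡⟨ sym (cong₂ (λ p q → p - k * q) (s-! v x i) (s-! v y i)) ⟩
    s v x ! i - k * s v y ! i
      ≡⟨ sym (-[]·-! (s v x) k (s v y) i) ⟩
    (s v x -[ k ]· s v y) ! i ∎
    where regroup : ∀ a k b p q d → (a - k * b) - (p - k * q) * d ≡ (a - p * d) - k * (b - q * d)
          regroup = solve-∀

  s-injective : ∀ v {x y} → s v x ≡ s v y → x ≡ y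
  s-injective v {x} {y} sx≡sy = trans (sym (s-involutive v x)) (trans (cong (s v) sx≡sy) (s-involutive v y))

  s-α : ∀ v → s v (α v) ≡ α v -[ + 2 ]· α v
  s-α v = cong (λ k → α v -[ k ]· α v) (trans (⟨α,∨⟩ v v) (C-diag v))

  s-α-! : ∀ k i → s k (α k) ! i ≡ - δ i k
  s-α-! k i = trans (cong (_! i) (s-α k))
                    (trans (-[]·-! (α k) (+ 2) (α k) i) (trans (cong (λ t → t - + 2 * t) (α-! k i)) (negate (δ i k))))
    where negate : ∀ a → a - + 2 * a ≡ - a
          negate = solve-∀

  Word : Set
  Word = List (Fin r)

  act : Word → V → V
  act []      x = x
  act (v ∷ w) x = s v (act w x)

  act-++ : ∀ w w′ x → act (w ++ w′) x ≡ act w (act w′ x)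
  act-++ []      w′ x = refl
  act-++ (v ∷ w) w′ x = cong (s v) (act-++ w w′ x)

  act-sub : ∀ w x k y → act w (x -[ k ]· y) ≡ act w x -[ k ]· act w y
  act-sub []      x k y = refl
  act-sub (v ∷ w) x k y = trans (cong (s v) (act-sub w x k y)) (s-sub v (act w x) k (act w y))

  act-reverse : ∀ w x → act (reverse w) (act w x) ≡ x
  act-reverse []      x = refl
  act-reverse (v ∷ w) x = begin
    act (reverse (v ∷ w)) (s v (act w x))  ≡⟨ cong (λ u → act u (s v (act w x))) (LP.unfold-reverse v w) ⟩
    act (reverse w ∷ʳ v) (s v (act w x))   ≡⟨ act-++ (reverse w) (v ∷ []) _ ⟩
    act (reverse w) (s v (s v (act w x)))  ≡⟨ cong (act (reverse w)) (s-involutive v (act w x)) ⟩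
    act (reverse w) (act w x)              ≡⟨ act-reverse w x ⟩
    x                                      ∎

  act-reverse′ : ∀ w x → act w (act (reverse w) x) ≡ x
  act-reverse′ w x = subst (λ u → act u (act (reverse w) x) ≡ x) (LP.reverse-involutive w) (act-reverse (reverse w) x)

  Positive Negative : V → Set
  Positive x = ∀ i → 0ℤ ≤ x ! i
  Negative x = ∀ i → x ! i ≤ 0ℤ

  Positive? : ∀ x → Dec (Positive x)
  Positive? x = FP.all? (λ i → 0ℤ ℤ.≤? x ! i)

  Negative? : ∀ x → Dec (Negative x)
  Negative? x = FP.all? (λ i → x ! i ℤ.≤? 0ℤ)

  α-positive : ∀ v → Positive (α v)
  α-positive v i = subst (0ℤ ≤_) (sym (α-! v i)) (0≤δ i v)
    where 0≤δ : ∀ i v → 0ℤ ≤ δ i v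
          0≤δ i v with does (i F.≟ v)
          ... | true  = ℤ.+≤+ ℕ.z≤n
          ... | false = ℤ.+≤+ ℕ.z≤n

  α-not-negative : ∀ v → ¬ Negative (α v)
  α-not-negative v αᵥ⁻ = 1≰0 (subst (_≤ 0ℤ) (trans (α-! v v) (ℤΣ.δ-refl v)) (αᵥ⁻ v))
    where 1≰0 : ¬ (1ℤ ≤ 0ℤ)
          1≰0 (ℤ.+≤+ ())

  s-α-not-positive : ∀ v → ¬ Positive (s v (α v))
  s-α-not-positive v sαᵥ⁺ = 0≰-1 (subst (0ℤ ≤_) (trans (s-α-! v v) (cong -_ (ℤΣ.δ-refl v))) (sαᵥ⁺ v))
    where 0≰-1 : ¬ (0ℤ ≤ -[1+ 0 ])
          0≰-1 ()

  record IsCombination (c : Fin r → ℤ) (z : Fin r → V) (y : V) : Set where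
    constructor combination
    field coords : ∀ k → y ! k ≡ sum (λ i → c i * z i ! k)

  weigh-combination : ∀ {c z y} f → IsCombination c z y → weigh f y ≡ sum (λ i → c i * weigh f (z i))
  weigh-combination {c} {z} {y} f (combination y≡∑cz) = begin
    sum (λ k → y ! k * f k)
      ≡⟨ ℤΣ.sum-cong-≗ (λ k → cong (_* f k) (y≡∑cz k)) ⟩
    sum (λ k → sum (λ i → c i * z i ! k) * f k)
      ≡⟨ ℤΣ.sum-cong-≗ (λ k → ℤΣ.*-distribʳ-sum (f k) (λ i → c i * z i ! k)) ⟩
    sum (λ k → sum (λ i → c i * z i ! k * f k))
      ≡⟨ ℤΣ.∑-comm (λ k i → c i * z i ! k * f k) ⟩
    sum (λ i → sum (λ k → c i * z i ! k * f k))
      ≡⟨ ℤΣ.sum-cong-≗ (λ i → ℤΣ.sum-cong-≗ (λ k → ℤP.*-assoc (c i) (z i ! k) (f k))) ⟩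
    sum (λ i → sum (λ k → c i * (z i ! k * f k)))
      ≡⟨ ℤΣ.sum-cong-≗ (λ i → sym (ℤΣ.*-distribˡ-sum (c i) (λ k → z i ! k * f k))) ⟩
    sum (λ i → c i * weigh f (z i)) ∎

  s-combination : ∀ {c z y} v → IsCombination c z y → IsCombination c (s v ∘ z) (s v y)
  s-combination {c} {z} {y} v y=∑cz@(combination y≡∑cz) = combination λ k → begin
    s v y ! k
      ≡⟨ s-! v y k ⟩
    y ! k - ⟨ y , v ∨⟩ * δ k v
      ≡⟨ cong₂ (λ p q → p - q * δ k v) (y≡∑cz k) (weigh-combination (λ u → C u v) y=∑cz) ⟩
    sum (λ i → c i * z i ! k) - sum (λ i → c i * ⟨ z i , v ∨⟩) * δ k v
      ≡⟨ cong (λ t → sum (λ i → c i * z i ! k) - t) (ℤP.*-comm (sum (λ i → c i * ⟨ z i , v ∨⟩)) (δ k v)) ⟩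
    sum (λ i → c i * z i ! k) - δ k v * sum (λ i → c i * ⟨ z i , v ∨⟩)
      ≡⟨ sym (ℤΣ.∑-sub-* (λ i → c i * z i ! k) (λ i → c i * ⟨ z i , v ∨⟩) (δ k v)) ⟩
    sum (λ i → c i * z i ! k - δ k v * (c i * ⟨ z i , v ∨⟩))
      ≡⟨ ℤΣ.sum-cong-≗ (λ i → trans (factor (c i) (z i ! k) (δ k v) ⟨ z i , v ∨⟩)
                                     (cong (λ t → c i * t) (sym (s-! v (z i) k)))) ⟩
    sum (λ i → c i * s v (z i) ! k) ∎
    where factor : ∀ a b d e → a * b - d * (a * e) ≡ a * (b - e * d)
          factor = solve-∀

  act-combination : ∀ w x → IsCombination (x !_) (act w ∘ α) (act w x)
  act-combination []      x = combination λ k →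
    sym (trans (ℤΣ.sum-cong-≗ (λ i → cong (x ! i *_) (trans (α-! i k) (ℤΣ.δ-sym k i)))) (ℤΣ.∑-*-δ (x !_) k))
  act-combination (v ∷ w) x = s-combination v (act-combination w x)

  module Symmetrizable (D : Fin r → ℚ) (D-pos : ∀ v → 0ℚ ℚ.< D v)
                       (symmetrizable : ∀ u v → D u ℚ.* toℚ (C v u) ≡ toℚ (C u v) ℚ.* D v) where

    ev : (Fin r → ℚ) → V → ℚ
    ev l x = ℚΣ.sum (λ i → toℚ (x ! i) ℚ.* l i)

    ev-cong : ∀ {l m} → (∀ i → l i ≡ m i) → ∀ x → ev l x ≡ ev m x
    ev-cong l≗m x = ℚΣ.sum-cong-≗ (λ i → cong (toℚ (x ! i) ℚ.*_) (l≗m i))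

    ev-α : ∀ l v → ev l (α v) ≡ l v
    ev-α l v = trans (ℚΣ.sum-cong-≗ (λ i → cong (ℚ._* l i) (trans (cong toℚ (α-! v i)) (toℚ-δ i v))))
                     (ℚΣ.∑-δ-* l v)

    ev-sub : ∀ l x k y → ev l (x -[ k ]· y) ≡ ev l x ℚ.- toℚ k ℚ.* ev l y
    ev-sub l x k y =
      trans (ℚΣ.sum-cong-≗ term) (ℚΣ.∑-sub-* (λ i → toℚ (x ! i) ℚ.* l i) (λ i → toℚ (y ! i) ℚ.* l i) (toℚ k))
      where
      distrib : ∀ a k b c → (a ℚ.- k ℚ.* b) ℚ.* c ≡ a ℚ.* c ℚ.- k ℚ.* (b ℚ.* c)
      distrib = solve 4 (λ a k b c → (a :- k :* b) :* c := a :* c :- k :* (b :* c)) refl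
      term : ∀ i → toℚ ((x -[ k ]· y) ! i) ℚ.* l i ≡
                   toℚ (x ! i) ℚ.* l i ℚ.- toℚ k ℚ.* (toℚ (y ! i) ℚ.* l i)
      term i = trans (cong (λ t → toℚ t ℚ.* l i) (-[]·-! x k y i))
               (trans (cong (ℚ._* l i) (trans (toℚ-- (x ! i) (k * y ! i))
                                              (cong (λ t → toℚ (x ! i) ℚ.- t) (toℚ-* k (y ! i)))))
                      (distrib (toℚ (x ! i)) (toℚ k) (toℚ (y ! i)) (l i)))

    ev-sub-functional : ∀ l q m x → ev (λ i → l i ℚ.- q ℚ.* m i) x ≡ ev l x ℚ.- q ℚ.* ev m x
    ev-sub-functional l q m x = trans (ℚΣ.sum-cong-≗ (λ i → distrib (toℚ (x ! i)) (l i) q (m i)))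
                                      (ℚΣ.∑-sub-* (λ i → toℚ (x ! i) ℚ.* l i) (λ i → toℚ (x ! i) ℚ.* m i) q)
      where
      distrib : ∀ a b q c → a ℚ.* (b ℚ.- q ℚ.* c) ≡ a ℚ.* b ℚ.- q ℚ.* (a ℚ.* c)
      distrib = solve 4 (λ a b q c → a :* (b :- q :* c) := a :* b :- q :* (a :* c)) refl

    Dominant : (Fin r → ℚ) → Set
    Dominant l = ∀ i → 0ℚ ℚ.≤ l i

    ev-nonneg : ∀ {l} → Dominant l → ∀ {x} → Positive x → 0ℚ ℚ.≤ ev l x
    ev-nonneg l⁺ x⁺ = ∑-nonnegℚ (λ i → *-nonneg (toℚ-mono-≤ (x⁺ i)) (l⁺ i))

    -- With D i = (α_i, α_i) this is 2 (x, y).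
    ⟪_,_⟫ : V → V → ℚ
    ⟪ x , y ⟫ = ev (λ k → D k ℚ.* toℚ ⟨ x , k ∨⟩) y

    ⟪,α⟫ : ∀ x v → ⟪ x , α v ⟫ ≡ D v ℚ.* toℚ ⟨ x , v ∨⟩
    ⟪,α⟫ x v = ev-α (λ k → D k ℚ.* toℚ ⟨ x , k ∨⟩) v

    ⟪α,⟫ : ∀ v y → ⟪ α v , y ⟫ ≡ D v ℚ.* toℚ ⟨ y , v ∨⟩
    ⟪α,⟫ v y = begin
      ev (λ k → D k ℚ.* toℚ ⟨ α v , k ∨⟩) y
        ≡⟨ ev-cong (λ k → trans (cong (λ t → D k ℚ.* toℚ t) (⟨α,∨⟩ v k)) (symmetrizable k v)) y ⟩
      ℚΣ.sum (λ k → toℚ (y ! k) ℚ.* (toℚ (C k v) ℚ.* D v))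
        ≡⟨ ℚΣ.sum-cong-≗ (λ k → sym (ℚP.*-assoc (toℚ (y ! k)) (toℚ (C k v)) (D v))) ⟩
      ℚΣ.sum (λ k → toℚ (y ! k) ℚ.* toℚ (C k v) ℚ.* D v)
        ≡⟨ sym (ℚΣ.*-distribʳ-sum (D v) (λ k → toℚ (y ! k) ℚ.* toℚ (C k v))) ⟩
      ℚΣ.sum (λ k → toℚ (y ! k) ℚ.* toℚ (C k v)) ℚ.* D v
        ≡⟨ cong (ℚ._* D v) (sym (trans (toℚ-∑ (λ k → y ! k * C k v))
                                       (ℚΣ.sum-cong-≗ (λ k → toℚ-* (y ! k) (C k v))))) ⟩
      toℚ ⟨ y , v ∨⟩ ℚ.* D v
        ≡⟨ ℚP.*-comm (toℚ ⟨ y , v ∨⟩) (D v) ⟩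
      D v ℚ.* toℚ ⟨ y , v ∨⟩ ∎

    ⟪,-[]·⟫ : ∀ x y k z → ⟪ x , y -[ k ]· z ⟫ ≡ ⟪ x , y ⟫ ℚ.- toℚ k ℚ.* ⟪ x , z ⟫
    ⟪,-[]·⟫ x y k z = ev-sub (λ m → D m ℚ.* toℚ ⟨ x , m ∨⟩) y k z

    ⟪-[]·,⟫ : ∀ x k z y → ⟪ x -[ k ]· z , y ⟫ ≡ ⟪ x , y ⟫ ℚ.- toℚ k ℚ.* ⟪ z , y ⟫
    ⟪-[]·,⟫ x k z y = trans (ev-cong coeff y) (ev-sub-functional _ (toℚ k) _ y)
      where
      distrib : ∀ d a k b → d ℚ.* (a ℚ.- k ℚ.* b) ≡ d ℚ.* a ℚ.- k ℚ.* (d ℚ.* b)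
      distrib = solve 4 (λ d a k b → d :* (a :- k :* b) := d :* a :- k :* (d :* b)) refl
      coeff : ∀ m → D m ℚ.* toℚ ⟨ x -[ k ]· z , m ∨⟩ ≡
                    D m ℚ.* toℚ ⟨ x , m ∨⟩ ℚ.- toℚ k ℚ.* (D m ℚ.* toℚ ⟨ z , m ∨⟩)
      coeff m = begin
        D m ℚ.* toℚ ⟨ x -[ k ]· z , m ∨⟩
          ≡⟨ cong (λ t → D m ℚ.* toℚ t) (weigh-sub (λ u → C u m) x k z) ⟩
        D m ℚ.* toℚ (⟨ x , m ∨⟩ - k * ⟨ z , m ∨⟩)
          ≡⟨ cong (D m ℚ.*_) (trans (toℚ-- ⟨ x , m ∨⟩ (k * ⟨ z , m ∨⟩))
                                    (cong (λ t → toℚ ⟨ x , m ∨⟩ ℚ.- t) (toℚ-* k ⟨ z , m ∨⟩))) ⟩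
        D m ℚ.* (toℚ ⟨ x , m ∨⟩ ℚ.- toℚ k ℚ.* toℚ ⟨ z , m ∨⟩)
          ≡⟨ distrib (D m) (toℚ ⟨ x , m ∨⟩) (toℚ k) (toℚ ⟨ z , m ∨⟩) ⟩
        D m ℚ.* toℚ ⟨ x , m ∨⟩ ℚ.- toℚ k ℚ.* (D m ℚ.* toℚ ⟨ z , m ∨⟩) ∎

    ⟪s,s⟫ : ∀ v x y → ⟪ s v x , s v y ⟫ ≡ ⟪ x , y ⟫
    ⟪s,s⟫ v x y = begin
      ⟪ s v x , s v y ⟫
        ≡⟨ ⟪-[]·,⟫ x a (α v) (s v y) ⟩
      ⟪ x , s v y ⟫ ℚ.- toℚ a ℚ.* ⟪ α v , s v y ⟫
        ≡⟨ cong₂ (λ p q → p ℚ.- toℚ a ℚ.* q) (⟪,-[]·⟫ x y b (α v)) (⟪α,⟫ v (s v y)) ⟩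
      (⟪ x , y ⟫ ℚ.- toℚ b ℚ.* ⟪ x , α v ⟫) ℚ.- toℚ a ℚ.* (D v ℚ.* toℚ ⟨ s v y , v ∨⟩)
        ≡⟨ cong₂ (λ p q → (⟪ x , y ⟫ ℚ.- toℚ b ℚ.* p) ℚ.- toℚ a ℚ.* (D v ℚ.* q))
                 (⟪,α⟫ x v) (trans (cong toℚ (⟨s,∨⟩-self v y)) (toℚ-neg b)) ⟩
      (⟪ x , y ⟫ ℚ.- toℚ b ℚ.* (D v ℚ.* toℚ a)) ℚ.- toℚ a ℚ.* (D v ℚ.* ℚ.- toℚ b)
        ≡⟨ cancel ⟪ x , y ⟫ (toℚ b) (toℚ a) (D v) ⟩
      ⟪ x , y ⟫ ∎
      where
      a = ⟨ x , v ∨⟩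
      b = ⟨ y , v ∨⟩
      cancel : ∀ p b a d → (p ℚ.- b ℚ.* (d ℚ.* a)) ℚ.- a ℚ.* (d ℚ.* ℚ.- b) ≡ p
      cancel = solve 4 (λ p b a d → (p :- b :* (d :* a)) :- a :* (d :* :- b) := p) refl

    ⟪act,act⟫ : ∀ w x y → ⟪ act w x , act w y ⟫ ≡ ⟪ x , y ⟫
    ⟪act,act⟫ []      x y = refl
    ⟪act,act⟫ (v ∷ w) x y = trans (⟪s,s⟫ v (act w x) (act w y)) (⟪act,act⟫ w x y)

    ⟪α,α⟫ : ∀ v → ⟪ α v , α v ⟫ ≡ D v ℚ.* two
    ⟪α,α⟫ v = trans (⟪,α⟫ (α v) v) (cong (λ t → D v ℚ.* toℚ t) (trans (⟨α,∨⟩ v v) (C-diag v)))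

    D-act : ∀ w p v → act w (α p) ≡ α v → D v ≡ D p
    D-act w p v wαp≡αv = *-cancelʳ-pos 0<two (begin
      D v ℚ.* two                           ≡⟨ sym (⟪α,α⟫ v) ⟩
      ⟪ α v , α v ⟫                         ≡⟨ cong₂ ⟪_,_⟫ (sym wαp≡αv) (sym wαp≡αv) ⟩
      ⟪ act w (α p) , act w (α p) ⟫         ≡⟨ ⟪act,act⟫ w (α p) (α p) ⟩
      ⟪ α p , α p ⟫                         ≡⟨ ⟪α,α⟫ p ⟩
      D p ℚ.* two                           ∎)

    ⟨act,∨⟩ : ∀ w p v → act w (α p) ≡ α v → ∀ y → ⟨ act w y , v ∨⟩ ≡ ⟨ y , p ∨⟩
    ⟨act,∨⟩ w p v wαp≡αv y = toℚ-injective (*-cancelˡ-pos (D-pos v) (begin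
      D v ℚ.* toℚ ⟨ act w y , v ∨⟩          ≡⟨ sym (⟪,α⟫ (act w y) v) ⟩
      ⟪ act w y , α v ⟫                     ≡⟨ cong (λ t → ⟪ act w y , t ⟫) (sym wαp≡αv) ⟩
      ⟪ act w y , act w (α p) ⟫             ≡⟨ ⟪act,act⟫ w y (α p) ⟩
      ⟪ y , α p ⟫                           ≡⟨ ⟪,α⟫ y p ⟩
      D p ℚ.* toℚ ⟨ y , p ∨⟩                 ≡⟨ cong (ℚ._* toℚ ⟨ y , p ∨⟩) (sym (D-act w p v wαp≡αv)) ⟩
      D v ℚ.* toℚ ⟨ y , p ∨⟩                 ∎))

    s-act : ∀ w p v → act w (α p) ≡ α v → ∀ y → s v (act w y) ≡ act w (s p y)
    s-act w p v wαp≡αv y = sym (trans (act-sub w y ⟨ y , p ∨⟩ (α p))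
      (cong₂ (λ k z → act w y -[ k ]· z) (sym (⟨act,∨⟩ w p v wαp≡αv y)) wαp≡αv))

module RootSystemProperties (R : RootSystem) where
  open RootSystem R

  D : Fin r → ℚ
  D v = B v v

  vq-α : ∀ (v j : Fin r) → vq (simple v) j ≡ ℚΣ.δ j v
  vq-α v j = trans (cong toℚ (VP.lookup∘tabulate _ j)) (toℚ-δ j v)

  form-α : ∀ x v → form B x (vq (simple v)) ≡ ℚΣ.sum (λ i → x i ℚ.* B i v)
  form-α x v = trans (Σℚ≡∑ (λ i → Σℚ (λ j → x i ℚ.* B i j ℚ.* vq (simple v) j))) (ℚΣ.sum-cong-≗ λ i → begin
    Σℚ (λ j → x i ℚ.* B i j ℚ.* vq (simple v) j)
      ≡⟨ Σℚ≡∑ (λ j → x i ℚ.* B i j ℚ.* vq (simple v) j) ⟩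
    ℚΣ.sum (λ j → x i ℚ.* B i j ℚ.* vq (simple v) j)
      ≡⟨ ℚΣ.sum-cong-≗ (λ j → cong (x i ℚ.* B i j ℚ.*_) (vq-α v j)) ⟩
    ℚΣ.sum (λ j → x i ℚ.* B i j ℚ.* ℚΣ.δ j v)
      ≡⟨ ℚΣ.∑-*-δ (λ j → x i ℚ.* B i j) v ⟩
    x i ℚ.* B i v ∎)

  form-αα : ∀ (v : Fin r) → form B (vq (simple v)) (vq (simple v)) ≡ D v
  form-αα v = trans (form-α (vq (simple v)) v)
                    (trans (ℚΣ.sum-cong-≗ (λ i → cong (ℚ._* B i v) (vq-α v i))) (ℚΣ.∑-δ-* (λ i → B i v) v))

  D-pos : ∀ v → 0ℚ ℚ.< D v
  D-pos v = subst (0ℚ ℚ.<_) (form-αα v)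
                  (B-posdef (vq (simple v)) (v , λ αᵥᵥ≡0 → 1≢0 (trans (sym (vq-α v v)) αᵥᵥ≡0)))
    where 1≢0 : ℚΣ.δ v v ≢ 0ℚ
          1≢0 δᵥᵥ≡0 with () ← trans (sym (ℚΣ.δ-refl v)) δᵥᵥ≡0

  C-diag : ∀ v → cartan v v ≡ + 2
  C-diag v = toℚ-injective (sym (*-cancelʳ-pos (D-pos v) (cartan-spec v v)))

  symmetrizable : ∀ u v → D u ℚ.* toℚ (cartan v u) ≡ toℚ (cartan u v) ℚ.* D v
  symmetrizable u v = begin
    D u ℚ.* toℚ (cartan v u)    ≡⟨ ℚP.*-comm (D u) _ ⟩
    toℚ (cartan v u) ℚ.* B u u  ≡⟨ sym (cartan-spec v u) ⟩
    two ℚ.* B v u               ≡⟨ cong (two ℚ.*_) (B-sym v u) ⟩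
    two ℚ.* B u v               ≡⟨ cartan-spec u v ⟩
    toℚ (cartan u v) ℚ.* D v    ∎

  open CartanMatrix cartan C-diag public
  open Symmetrizable D D-pos symmetrizable public

  two-form-α : ∀ x v → two ℚ.* form B (vq x) (vq (α v)) ≡ toℚ ⟨ x , v ∨⟩ ℚ.* D v
  two-form-α x v = begin
    two ℚ.* form B (vq x) (vq (α v))
      ≡⟨ cong (two ℚ.*_) (form-α (vq x) v) ⟩
    two ℚ.* ℚΣ.sum (λ i → vq x i ℚ.* B i v)
      ≡⟨ ℚΣ.*-distribˡ-sum two (λ i → vq x i ℚ.* B i v) ⟩
    ℚΣ.sum (λ i → two ℚ.* (vq x i ℚ.* B i v))
      ≡⟨ ℚΣ.sum-cong-≗ term ⟩
    ℚΣ.sum (λ i → toℚ (x ! i * cartan i v) ℚ.* D v)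
      ≡⟨ sym (ℚΣ.*-distribʳ-sum (D v) (λ i → toℚ (x ! i * cartan i v))) ⟩
    ℚΣ.sum (λ i → toℚ (x ! i * cartan i v)) ℚ.* D v
      ≡⟨ cong (ℚ._* D v) (sym (toℚ-∑ (λ i → x ! i * cartan i v))) ⟩
    toℚ ⟨ x , v ∨⟩ ℚ.* D v ∎
    where
    swap : ∀ t a b → t ℚ.* (a ℚ.* b) ≡ a ℚ.* (t ℚ.* b)
    swap = solve 3 (λ t a b → t :* (a :* b) := a :* (t :* b)) refl
    term : ∀ i → two ℚ.* (vq x i ℚ.* B i v) ≡ toℚ (x ! i * cartan i v) ℚ.* D v
    term i = begin
      two ℚ.* (vq x i ℚ.* B i v)                  ≡⟨ swap two (vq x i) (B i v) ⟩
      vq x i ℚ.* (two ℚ.* B i v)                  ≡⟨ cong (vq x i ℚ.*_) (cartan-spec i v) ⟩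
      vq x i ℚ.* (toℚ (cartan i v) ℚ.* D v)       ≡⟨ sym (ℚP.*-assoc (vq x i) _ (D v)) ⟩
      vq x i ℚ.* toℚ (cartan i v) ℚ.* D v         ≡⟨ cong (ℚ._* D v) (sym (toℚ-* (x ! i) (cartan i v))) ⟩
      toℚ (x ! i * cartan i v) ℚ.* D v            ∎

  s-root : ∀ {x} v → x ∈ roots → s v x ∈ roots
  s-root {x} v x∈Φ = reflection (simple∈ v) x∈Φ ⟨ x , v ∨⟩
    (trans (two-form-α x v) (cong (toℚ ⟨ x , v ∨⟩ ℚ.*_) (sym (form-αα v))))

  act-root : ∀ {x} w → x ∈ roots → act w x ∈ roots
  act-root []      x∈Φ = x∈Φ
  act-root (v ∷ w) x∈Φ = s-root v (act-root w x∈Φ)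

  form-self≡0 : ∀ z → (∀ v → ⟨ z , v ∨⟩ ≡ 0ℤ) → form B (vq z) (vq z) ≡ 0ℚ
  form-self≡0 z z⊥ =
    trans (Σℚ≡∑ (λ i → Σℚ (λ j → vq z i ℚ.* B i j ℚ.* vq z j))) (ℚΣ.∑-zero _ row≡0)
    where
    rearrange : ∀ a b c → a ℚ.* b ℚ.* c ≡ a ℚ.* (c ℚ.* b)
    rearrange = solve 3 (λ a b c → a :* b :* c := a :* (c :* b)) refl
    column≡0 : ∀ i → ℚΣ.sum (λ j → vq z j ℚ.* B j i) ≡ 0ℚ
    column≡0 i = *-cancelˡ-pos 0<two (begin
      two ℚ.* ℚΣ.sum (λ j → vq z j ℚ.* B j i)   ≡⟨ cong (two ℚ.*_) (sym (form-α (vq z) i)) ⟩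
      two ℚ.* form B (vq z) (vq (α i))          ≡⟨ two-form-α z i ⟩
      toℚ ⟨ z , i ∨⟩ ℚ.* D i                     ≡⟨ cong (λ t → toℚ t ℚ.* D i) (z⊥ i) ⟩
      0ℚ ℚ.* D i                                ≡⟨ ℚP.*-zeroˡ (D i) ⟩
      0ℚ                                        ≡⟨ sym (ℚP.*-zeroʳ two) ⟩
      two ℚ.* 0ℚ                                ∎)
    row≡0 : ∀ i → Σℚ (λ j → vq z i ℚ.* B i j ℚ.* vq z j) ≡ 0ℚ
    row≡0 i = begin
      Σℚ (λ j → vq z i ℚ.* B i j ℚ.* vq z j)
        ≡⟨ Σℚ≡∑ (λ j → vq z i ℚ.* B i j ℚ.* vq z j) ⟩
      ℚΣ.sum (λ j → vq z i ℚ.* B i j ℚ.* vq z j)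
        ≡⟨ ℚΣ.sum-cong-≗ (λ j → trans (cong (λ b → vq z i ℚ.* b ℚ.* vq z j) (B-sym i j))
                                      (rearrange (vq z i) (B j i) (vq z j))) ⟩
      ℚΣ.sum (λ j → vq z i ℚ.* (vq z j ℚ.* B j i))
        ≡⟨ sym (ℚΣ.*-distribˡ-sum (vq z i) (λ j → vq z j ℚ.* B j i)) ⟩
      vq z i ℚ.* ℚΣ.sum (λ j → vq z j ℚ.* B j i)
        ≡⟨ cong (vq z i ℚ.*_) (column≡0 i) ⟩
      vq z i ℚ.* 0ℚ
        ≡⟨ ℚP.*-zeroʳ (vq z i) ⟩
      0ℚ ∎

  nondegenerate : ∀ z → (∀ v → ⟨ z , v ∨⟩ ≡ 0ℤ) → ∀ i → z ! i ≡ 0ℤ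
  nondegenerate z z⊥ = decidable-stable (FP.all? (λ i → z ! i ℤ.≟ 0ℤ)) λ z≢0 →
    let (i , zᵢ≢0) = FP.¬∀⟶∃¬ r (λ i → z ! i ≡ 0ℤ) (λ i → z ! i ℤ.≟ 0ℤ) z≢0 in
    ℚP.<-irrefl (sym (form-self≡0 z z⊥)) (B-posdef (vq z) (i , zᵢ≢0 ∘ toℚ-injective))

  root-nonzero : ∀ {x} → x ∈ roots → ∃ λ i → x ! i ≢ 0ℤ
  root-nonzero = LAll.lookup roots-nonzero

  root-sign : ∀ {x} → x ∈ roots → Positive x ⊎ Negative x
  root-sign = LAll.lookup base

  positive-flip : ∀ {x} v → x ∈ roots → Positive x → Negative (s v x) → x ≡ α v
  positive-flip {x} v x∈Φ x⁺ sx⁻ = conclude (reduced (simple∈ v) x∈Φ (toℚ (x ! v)) proportional)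
    where
    off-diagonal : ∀ {i} → i ≢ v → x ! i ≡ 0ℤ
    off-diagonal i≢v = ℤP.≤-antisym (subst (_≤ 0ℤ) (s-!-≢ v x i≢v) (sx⁻ _)) (x⁺ _)

    proportional : ∀ i → vq x i ≡ toℚ (x ! v) ℚ.* vq (α v) i
    proportional i with i F.≟ v
    ... | yes refl = sym (trans (cong (toℚ (x ! v) ℚ.*_) (trans (vq-α v v) (ℚΣ.δ-refl v))) (ℚP.*-identityʳ _))
    ... | no i≢v   = trans (cong toℚ (off-diagonal i≢v))
                           (sym (trans (cong (toℚ (x ! v) ℚ.*_) (trans (vq-α v i) (ℚΣ.δ-≢ i≢v)))
                                       (ℚP.*-zeroʳ (toℚ (x ! v)))))

    coordinates : toℚ (x ! v) ≡ 1ℚ → ∀ i → x ! i ≡ α v ! i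
    coordinates xᵥ≡1 i with i F.≟ v
    ... | yes refl = trans (toℚ-injective xᵥ≡1) (sym (trans (α-! v v) (ℤΣ.δ-refl v)))
    ... | no i≢v   = trans (off-diagonal i≢v) (sym (trans (α-! v i) (ℤΣ.δ-≢ i≢v)))

    conclude : toℚ (x ! v) ≡ 1ℚ ⊎ toℚ (x ! v) ≡ ℚ.- 1ℚ → x ≡ α v
    conclude (inj₁ xᵥ≡1)  = lookup-ext (coordinates xᵥ≡1)
    conclude (inj₂ xᵥ≡-1) with () ← subst (0ℤ ≤_) (toℚ-injective {b = -[1+ 0 ]} xᵥ≡-1) (x⁺ v)

  deletion : ∀ w p → Negative (act w (α p)) →
             ∃ λ w′ → length w′ ℕ.< length w × (∀ y → act (w ∷ʳ p) y ≡ act w′ y)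
  deletion []      p αₚ⁻   = contradiction αₚ⁻ (α-not-negative p)
  deletion (v ∷ u) p vuαₚ⁻ = [ drop-v , keep-v ]′ (root-sign (act-root u (simple∈ p)))
    where
    Shorter = ∃ λ w′ → length w′ ℕ.< length (v ∷ u) × (∀ y → act (v ∷ u ∷ʳ p) y ≡ act w′ y)
    drop-v : Positive (act u (α p)) → Shorter
    drop-v uαₚ⁺ = u , ℕP.≤-refl , λ y → begin
      s v (act (u ∷ʳ p) y)     ≡⟨ cong (s v) (act-++ u (p ∷ []) y) ⟩
      s v (act u (s p y))      ≡⟨ s-act u p v uαₚ≡αᵥ (s p y) ⟩
      act u (s p (s p y))      ≡⟨ cong (act u) (s-involutive p y) ⟩
      act u y                  ∎
      where uαₚ≡αᵥ = positive-flip v (act-root u (simple∈ p)) uαₚ⁺ vuαₚ⁻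
    keep-v : Negative (act u (α p)) → Shorter
    keep-v uαₚ⁻ = let (u′ , shorter , usₚ≈u′) = deletion u p uαₚ⁻ in
                  v ∷ u′ , ℕ.s≤s shorter , λ y → cong (s v) (usₚ≈u′ y)

  ev-act-∷ʳ : ∀ l w p x →
              ev l (act (w ∷ʳ p) x) ≡ ev l (act w x) ℚ.- toℚ ⟨ x , p ∨⟩ ℚ.* ev l (act w (α p))
  ev-act-∷ʳ l w p x = begin
    ev l (act (w ∷ʳ p) x)
      ≡⟨ cong (ev l) (act-++ w (p ∷ []) x) ⟩
    ev l (act w (x -[ ⟨ x , p ∨⟩ ]· α p))
      ≡⟨ cong (ev l) (act-sub w x ⟨ x , p ∨⟩ (α p)) ⟩
    ev l (act w x -[ ⟨ x , p ∨⟩ ]· act w (α p))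
      ≡⟨ ev-sub l (act w x) ⟨ x , p ∨⟩ (act w (α p)) ⟩
    ev l (act w x) ℚ.- toℚ ⟨ x , p ∨⟩ ℚ.* ev l (act w (α p)) ∎

  ev-act-∷ʳ-α : ∀ l w p → ev l (act (w ∷ʳ p) (α p)) ≡ ℚ.- ev l (act w (α p))
  ev-act-∷ʳ-α l w p = trans (ev-act-∷ʳ l w p (α p))
                            (trans (cong (λ t → y ℚ.- toℚ t ℚ.* y) (trans (⟨α,∨⟩ p p) (C-diag p))) (reflect y))
    where
    y = ev l (act w (α p))
    reflect : ∀ y → y ℚ.- two ℚ.* y ≡ ℚ.- y
    reflect y = trans (cong (λ t → y ℚ.- t) (trans (ℚP.*-distribʳ-+ y 1ℚ 1ℚ)
                                                   (cong₂ ℚ._+_ (ℚP.*-identityˡ y) (ℚP.*-identityˡ y))))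
                      (solve 1 (λ y → y :- (y :+ y) := :- y) refl y)

  ev-act-∷ʳ-invariant : ∀ l w p → ev l (act w (α p)) ≡ 0ℚ → ∀ x → ev l (act (w ∷ʳ p) x) ≡ ev l (act w x)
  ev-act-∷ʳ-invariant l w p wαₚ⊥l x = begin
    ev l (act (w ∷ʳ p) x)
      ≡⟨ ev-act-∷ʳ l w p x ⟩
    ev l (act w x) ℚ.- toℚ ⟨ x , p ∨⟩ ℚ.* ev l (act w (α p))
      ≡⟨ cong (λ t → ev l (act w x) ℚ.- toℚ ⟨ x , p ∨⟩ ℚ.* t) wαₚ⊥l ⟩
    ev l (act w x) ℚ.- toℚ ⟨ x , p ∨⟩ ℚ.* 0ℚ
      ≡⟨ cong (λ t → ev l (act w x) ℚ.- t) (ℚP.*-zeroʳ (toℚ ⟨ x , p ∨⟩)) ⟩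
    ev l (act w x) ℚ.- 0ℚ
      ≡⟨ ℚP.+-identityʳ (ev l (act w x)) ⟩
    ev l (act w x) ∎

  -- Induction on the length of w = w′ sₚ: if w′ α_p > 0 then l (w′ α_p) ≥ 0 and l (w α_p) = - l (w′ α_p) ≥ 0,
  -- so sₚ can be dropped; if w′ α_p < 0 then w′ sₚ has a shorter expression.
  dominant-fixed : ∀ {l} → Dominant l → ∀ w → Dominant (ev l ∘ act w ∘ α) → ∀ x → ev l (act w x) ≡ ev l x
  dominant-fixed {l} l⁺ w = go w (reverseView w) (ℕI.<-wellFounded (length w))
    where
    go : ∀ w → Reverse w → Acc ℕ._<_ (length w) →
         Dominant (ev l ∘ act w ∘ α) → ∀ x → ev l (act w x) ≡ ev l x
    go .[]         []                 _         lw⁺ x = refl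
    go .(w′ ∷ʳ p)  (w′ ∶ w′-view ∶ʳ p) (acc rec) lw⁺ x =
      [ innermost-positive , innermost-negative ]′ (root-sign (act-root w′ (simple∈ p)))
      where
      innermost-positive : Positive (act w′ (α p)) → ev l (act (w′ ∷ʳ p) x) ≡ ev l x
      innermost-positive w′αₚ⁺ = trans (drop-p x) (go w′ w′-view (rec (length<∷ʳ w′ p)) lw′⁺ x)
        where
        y = ev l (act w′ (α p))
        y≡0 : y ≡ 0ℚ
        y≡0 = ℚP.≤-antisym
          (subst (ℚ._≤ 0ℚ) (-‿involutive y)
                 (ℚP.neg-antimono-≤ (subst (0ℚ ℚ.≤_) (ev-act-∷ʳ-α l w′ p) (lw⁺ p))))
          (ev-nonneg l⁺ {act w′ (α p)} w′αₚ⁺)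
        drop-p = ev-act-∷ʳ-invariant l w′ p y≡0
        lw′⁺ : Dominant (ev l ∘ act w′ ∘ α)
        lw′⁺ v = subst (0ℚ ℚ.≤_) (drop-p (α v)) (lw⁺ v)
      innermost-negative : Negative (act w′ (α p)) → ev l (act (w′ ∷ʳ p) x) ≡ ev l x
      innermost-negative w′αₚ⁻ = trans (cong (ev l) (w≈w″ x))
                                       (go w″ (reverseView w″) (rec (ℕP.<-trans shorter (length<∷ʳ w′ p))) lw″⁺ x)
        where
        w″ = proj₁ (deletion w′ p w′αₚ⁻)
        shorter = proj₁ (proj₂ (deletion w′ p w′αₚ⁻))
        w≈w″ = proj₂ (proj₂ (deletion w′ p w′αₚ⁻))
        lw″⁺ : Dominant (ev l ∘ act w″ ∘ α)
        lw″⁺ v = subst (λ z → 0ℚ ℚ.≤ ev l z) (w≈w″ (α v)) (lw⁺ v)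

  Φ⁺ : List V
  Φ⁺ = positiveRoots R

  ∈Φ⁺⁻ : ∀ {β} → β ∈ Φ⁺ → β ∈ roots × Positive β
  ∈Φ⁺⁻ {β} β∈Φ⁺ = let (β∈Φ , β⁺) = MP.∈-filter⁻ (VAll.all? (0ℤ ℤ.≤?_)) {xs = roots} β∈Φ⁺ in
                  β∈Φ , VAllP.lookup⁺ β⁺

  ∈Φ⁺⁺ : ∀ {β} → β ∈ roots → Positive β → β ∈ Φ⁺
  ∈Φ⁺⁺ {β} β∈Φ β⁺ = MP.∈-filter⁺ (VAll.all? (0ℤ ℤ.≤?_)) β∈Φ (VAllP.lookup⁻ β⁺)

  Φ⁺-unique : Unique Φ⁺
  Φ⁺-unique = UP.filter⁺ (VAll.all? (0ℤ ℤ.≤?_)) roots-unique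

  α∈Φ⁺ : ∀ v → α v ∈ Φ⁺
  α∈Φ⁺ v = ∈Φ⁺⁺ (simple∈ v) (α-positive v)

  s-∈Φ⁺ : ∀ v {β} → β ∈ Φ⁺ → β ≢ α v → s v β ∈ Φ⁺
  s-∈Φ⁺ v {β} β∈Φ⁺ β≢αᵥ =
    [ ∈Φ⁺⁺ sβ∈Φ , (λ sβ⁻ → contradiction (positive-flip v β∈Φ β⁺ sβ⁻) β≢αᵥ) ]′ (root-sign sβ∈Φ)
    where
    β∈Φ = proj₁ (∈Φ⁺⁻ β∈Φ⁺)
    β⁺ = proj₂ (∈Φ⁺⁻ β∈Φ⁺)
    sβ∈Φ = s-root v β∈Φ

  s-Φ⁺-↭ : ∀ v → α v ∷ map (s v) Φ⁺ ↭ s v (α v) ∷ Φ⁺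
  s-Φ⁺-↭ v = ∼bag⇒↭ (unique∧set⇒bag lhs-unique rhs-unique (mk⇔ to from))
    where
    lhs-unique : Unique (α v ∷ map (s v) Φ⁺)
    lhs-unique = LAll.tabulate αᵥ∉ ∷ UP.map⁺ (s-injective v) Φ⁺-unique
      where
      αᵥ∉ : ∀ {x} → x ∈ map (s v) Φ⁺ → α v ≢ x
      αᵥ∉ x∈sΦ⁺ αᵥ≡x = let (β , β∈Φ⁺ , x≡sβ) = MP.∈-map⁻ (s v) x∈sΦ⁺ in
        s-α-not-positive v (subst Positive (sym (trans (cong (s v) (trans αᵥ≡x x≡sβ)) (s-involutive v β)))
                                           (proj₂ (∈Φ⁺⁻ β∈Φ⁺)))
    rhs-unique : Unique (s v (α v) ∷ Φ⁺)
    rhs-unique = LAll.tabulate (λ β∈Φ⁺ sαᵥ≡β → s-α-not-positive v (subst Positive (sym sαᵥ≡β) (proj₂ (∈Φ⁺⁻ β∈Φ⁺))))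
                 ∷ Φ⁺-unique
    to : ∀ {x} → x ∈ α v ∷ map (s v) Φ⁺ → x ∈ s v (α v) ∷ Φ⁺
    to (here refl)    = there (α∈Φ⁺ v)
    to (there x∈sΦ⁺) = let (β , β∈Φ⁺ , x≡sβ) = MP.∈-map⁻ (s v) x∈sΦ⁺ in
                        subst (_∈ s v (α v) ∷ Φ⁺) (sym x≡sβ) (reflected β∈Φ⁺ (β ≟ α v))
      where
      reflected : ∀ {β} → β ∈ Φ⁺ → Dec (β ≡ α v) → s v β ∈ s v (α v) ∷ Φ⁺
      reflected _     (yes refl)  = here refl
      reflected β∈Φ⁺ (no β≢αᵥ)  = there (s-∈Φ⁺ v β∈Φ⁺ β≢αᵥ)
    from : ∀ {x} → x ∈ s v (α v) ∷ Φ⁺ → x ∈ α v ∷ map (s v) Φ⁺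
    from (here refl)     = there (MP.∈-map⁺ (s v) (α∈Φ⁺ v))
    from {x} (there x∈Φ⁺) = unreflected (x ≟ α v)
      where
      unreflected : Dec (x ≡ α v) → x ∈ α v ∷ map (s v) Φ⁺
      unreflected (yes refl) = here refl
      unreflected (no x≢αᵥ)  =
        there (subst (_∈ map (s v) Φ⁺) (s-involutive v x) (MP.∈-map⁺ (s v) (s-∈Φ⁺ v x∈Φ⁺ x≢αᵥ)))

  ∑Φ⁺ : V
  ∑Φ⁺ = tabulate (sumPositive R)

  ⟨∑Φ⁺,∨⟩≡sum : ∀ v → ⟨ ∑Φ⁺ , v ∨⟩ ≡ sumₗ (map ⟨_, v ∨⟩ Φ⁺)
  ⟨∑Φ⁺,∨⟩≡sum v =
    trans (ℤΣ.sum-cong-≗ (λ k → cong (_* cartan k v) (VP.lookup∘tabulate (sumPositive R) k))) (columns Φ⁺)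
    where
    columns : ∀ L → sum (λ k → foldr (λ β t → β ! k + t) 0ℤ L * cartan k v) ≡ sumₗ (map ⟨_, v ∨⟩ L)
    columns []      = ℤΣ.∑-zero _ (λ k → ℤP.*-zeroˡ (cartan k v))
    columns (β ∷ L) = trans (ℤΣ.sum-cong-≗ (λ k → ℤP.*-distribʳ-+ (cartan k v) (β ! k) _))
                            (trans (ℤΣ.∑-distrib-+ (λ k → β ! k * cartan k v) _) (cong (λ t → ⟨ β , v ∨⟩ + t) (columns L)))

  ⟨∑Φ⁺,∨⟩ : ∀ v → ⟨ ∑Φ⁺ , v ∨⟩ ≡ + 2
  ⟨∑Φ⁺,∨⟩ v = trans (⟨∑Φ⁺,∨⟩≡sum v) (balance (begin
    + 2 + - S
      ≡⟨ cong₂ _+_ (sym gαᵥ≡2) (sym (sumₗ-neg g Φ⁺)) ⟩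
    g (α v) + sumₗ (map (λ β → - g β) Φ⁺)
      ≡⟨ cong (λ L → g (α v) + sumₗ L)
              (trans (LP.map-cong (λ β → sym (⟨s,∨⟩-self v β)) Φ⁺) (LP.map-∘ Φ⁺)) ⟩
    g (α v) + sumₗ (map g (map (s v) Φ⁺))
      ≡⟨ sumₗ-↭ (PermP.map⁺ g (s-Φ⁺-↭ v)) ⟩
    g (s v (α v)) + S
      ≡⟨ cong (_+ S) (trans (⟨s,∨⟩-self v (α v)) (cong -_ gαᵥ≡2)) ⟩
    - + 2 + S ∎))
    where
    g = ⟨_, v ∨⟩
    S = sumₗ (map g Φ⁺)
    gαᵥ≡2 : g (α v) ≡ + 2
    gαᵥ≡2 = trans (⟨α,∨⟩ v v) (C-diag v)
    balance : ∀ {S} → + 2 + - S ≡ - + 2 + S → S ≡ + 2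
    balance {S} eq = trans (shift S) (cong (_+ + 2) (x≡-x⇒x≡0 (trans (flip₁ S) (trans (sym eq) (flip₂ S)))))
      where
      shift : ∀ S → S ≡ S - + 2 + + 2
      shift = solve-∀
      flip₁ : ∀ S → S - + 2 ≡ - + 2 + S
      flip₁ = solve-∀
      flip₂ : ∀ S → + 2 + - S ≡ - (S - + 2)
      flip₂ = solve-∀

  positiveCount : Word → ℕ
  positiveCount w = length (filter Positive? (map (act w) Φ⁺))

  act-s-α-not-positive : ∀ w v → Positive (act w (α v)) → ¬ Positive (act w (s v (α v)))
  act-s-α-not-positive w v x⁺ wsαᵥ⁺ = xᵢ≢0 (ℤP.≤-antisym xᵢ≤0 (x⁺ i))
    where
    x = act w (α v)
    i = proj₁ (root-nonzero (act-root w (simple∈ v)))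
    xᵢ≢0 = proj₂ (root-nonzero (act-root w (simple∈ v)))
    negate : ∀ a → a - + 2 * a ≡ - a
    negate = solve-∀
    0≤-xᵢ : 0ℤ ≤ - (x ! i)
    0≤-xᵢ = subst (0ℤ ≤_) (trans (-[]·-! x (+ 2) x i) (negate (x ! i)))
              (subst (λ y → 0ℤ ≤ y ! i) (trans (cong (act w) (s-α v)) (act-sub w (α v) (+ 2) (α v))) (wsαᵥ⁺ i))
    xᵢ≤0 : x ! i ≤ 0ℤ
    xᵢ≤0 = subst (_≤ 0ℤ) (ℤP.neg-involutive (x ! i)) (ℤP.neg-mono-≤ 0≤-xᵢ)

  positiveCount-∷ʳ : ∀ w v → Positive (act w (α v)) → ℕ.suc (positiveCount (w ∷ʳ v)) ≡ positiveCount w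
  positiveCount-∷ʳ w v wαᵥ⁺ = begin
    ℕ.suc (length (filter Positive? (map (act (w ∷ʳ v)) Φ⁺)))
      ≡⟨ cong (λ L → ℕ.suc (length (filter Positive? L))) w∷ʳv-map ⟩
    ℕ.suc (length (filter Positive? (map (act w) (map (s v) Φ⁺))))
      ≡⟨ cong length (sym (LP.filter-accept Positive? wαᵥ⁺)) ⟩
    length (filter Positive? (map (act w) (α v ∷ map (s v) Φ⁺)))
      ≡⟨ PermP.↭-length (PermP.filter-↭ Positive? (PermP.map⁺ (act w) (s-Φ⁺-↭ v))) ⟩
    length (filter Positive? (map (act w) (s v (α v) ∷ Φ⁺)))
      ≡⟨ cong length (LP.filter-reject Positive? (act-s-α-not-positive w v wαᵥ⁺)) ⟩
    length (filter Positive? (map (act w) Φ⁺)) ∎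
    where
    w∷ʳv-map : map (act (w ∷ʳ v)) Φ⁺ ≡ map (act w) (map (s v) Φ⁺)
    w∷ʳv-map = trans (LP.map-cong (λ x → act-++ w (v ∷ []) x) Φ⁺) (LP.map-∘ Φ⁺)

  negating-word : ∃ λ w₀ → ∀ v → Negative (act w₀ (α v))
  negating-word = descent (λ w → FP.all? (λ v → Negative? (act w (α v)))) positiveCount step []
    where
    step : ∀ w → ¬ (∀ v → Negative (act w (α v))) → ∃ λ w′ → positiveCount w′ ℕ.< positiveCount w
    step w ¬w⁻ =
      let (v , ¬wαᵥ⁻) = FP.¬∀⟶∃¬ r (λ v → Negative (act w (α v))) (λ v → Negative? (act w (α v))) ¬w⁻
          wαᵥ⁺ = [ id , (λ wαᵥ⁻ → contradiction wαᵥ⁻ ¬wαᵥ⁻) ]′ (root-sign (act-root w (simple∈ v)))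
      in w ∷ʳ v , ℕP.≤-reflexive (positiveCount-∷ʳ w v wαᵥ⁺)

  w₀ : Word
  w₀ = proj₁ negating-word

  w₀-negative : ∀ v → Negative (act w₀ (α v))
  w₀-negative = proj₂ negating-word

  w₀-positive : ∀ {β} → Positive β → Negative (act w₀ β)
  w₀-positive {β} β⁺ m = subst (_≤ 0ℤ) (sym (IsCombination.coords (act-combination w₀ β) m))
                               (∑-nonpos (λ i → *-nonneg-nonpos (β⁺ i) (w₀-negative i m)))

  w₀⁻¹-negative : ∀ v → Negative (act (reverse w₀) (α v))
  w₀⁻¹-negative v =
    [ (λ w₀⁻¹αᵥ⁺ → contradiction (subst Negative (act-reverse′ w₀ (α v)) (w₀-positive w₀⁻¹αᵥ⁺)) (α-not-negative v))
    , (λ w₀⁻¹αᵥ⁻ → w₀⁻¹αᵥ⁻) ]′ (root-sign (act-root (reverse w₀) (simple∈ v)))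

  ht-negative : ∀ {x} → x ∈ roots → Negative x → ht x ≤ -[1+ 0 ]
  ht-negative {x} x∈Φ x⁻ = ℤP.≤-trans (∑≤term (λ k → x·1≤0 k) i)
                                      (subst (_≤ -[1+ 0 ]) (sym (ℤP.*-identityʳ (x ! i))) (nonpos≢0⇒≤-1 (x⁻ i) xᵢ≢0))
    where
    i = proj₁ (root-nonzero x∈Φ)
    xᵢ≢0 = proj₂ (root-nonzero x∈Φ)
    x·1≤0 : ∀ k → x ! k * 1ℤ ≤ 0ℤ
    x·1≤0 k = subst (_≤ 0ℤ) (sym (ℤP.*-identityʳ (x ! k))) (x⁻ k)

  -- Heights: α_v = w₀⁻¹ (w₀ α_v), so 1 = Σᵢ (w₀ α_v)ᵢ ht (w₀⁻¹ αᵢ), a sum of products of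
  -- nonnegative integers -(w₀ α_v)ᵢ with integers -ht (w₀⁻¹ αᵢ) ≥ 1.
  w₀-simple : ∀ v → ∃ λ k → act w₀ (α v) ≡ s k (α k)
  w₀-simple v = k , lookup-ext λ i →
    trans (sym (ℤP.neg-involutive (γ ! i))) (trans (cong -_ (g≡δ i)) (sym (s-α-! k i)))
    where
    γ = act w₀ (α v)
    g : Fin r → ℤ
    g i = - (γ ! i)
    h : Fin r → ℤ
    h i = - ht (act (reverse w₀) (α i))
    ∑gh≡1 : sum (λ i → g i * h i) ≡ 1ℤ
    ∑gh≡1 = begin
      sum (λ i → g i * h i)
        ≡⟨ ℤΣ.sum-cong-≗ (λ i → neg*neg (γ ! i) (ht (act (reverse w₀) (α i)))) ⟩
      sum (λ i → γ ! i * ht (act (reverse w₀) (α i)))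
        ≡⟨ sym (weigh-combination (λ _ → 1ℤ) (act-combination (reverse w₀) γ)) ⟩
      ht (act (reverse w₀) γ)
        ≡⟨ cong ht (act-reverse w₀ (α v)) ⟩
      ht (α v)
        ≡⟨ weigh-α (λ _ → 1ℤ) v ⟩
      1ℤ ∎
      where neg*neg : ∀ a b → (- a) * (- b) ≡ a * b
            neg*neg = solve-∀
    unit = ∑-*≡1⇒δ g h (λ i → ℤP.neg-mono-≤ (w₀-negative v i))
                       (λ i → ℤP.neg-mono-≤ (ht-negative (act-root (reverse w₀) (simple∈ i)) (w₀⁻¹-negative i))) ∑gh≡1
    k = proj₁ unit
    g≡δ = proj₂ unit

  σ : Fin r → Fin r
  σ v = proj₁ (w₀-simple v)

  D-σ : ∀ v → D (σ v) ≡ D v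
  D-σ v = D-act (σ v ∷ w₀) v (σ v) (trans (cong (s (σ v)) (proj₂ (w₀-simple v))) (s-involutive (σ v) (α (σ v))))

  ⟨,∨⟩+nbr : ∀ c v → ⟨ c , v ∨⟩ + nbr R c v ≡ + 2 * c ! v
  ⟨,∨⟩+nbr c v = begin
    ⟨ c , v ∨⟩ + nbr R c v
      ≡⟨ cong (λ t → ⟨ c , v ∨⟩ + t) (Σℤ≡∑ (λ u → if does (u F.≟ v) then 0ℤ else nn R v u * c ! u)) ⟩
    sum (λ u → c ! u * cartan u v) + sum (λ u → if does (u F.≟ v) then 0ℤ else nn R v u * c ! u)
      ≡⟨ sym (ℤΣ.∑-distrib-+ (λ u → c ! u * cartan u v) _) ⟩
    sum (λ u → c ! u * cartan u v + (if does (u F.≟ v) then 0ℤ else nn R v u * c ! u))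
      ≡⟨ ℤΣ.sum-cong-≗ (λ u → diagonal u (u F.≟ v)) ⟩
    sum (λ u → c ! u * cartan u v * δ u v)
      ≡⟨ ℤΣ.∑-*-δ (λ u → c ! u * cartan u v) v ⟩
    c ! v * cartan v v
      ≡⟨ trans (cong (λ t → c ! v * t) (C-diag v)) (ℤP.*-comm (c ! v) (+ 2)) ⟩
    + 2 * c ! v ∎
    where
    diagonal : ∀ u (u≟v : Dec (u ≡ v)) →
               c ! u * cartan u v + (if does u≟v then 0ℤ else nn R v u * c ! u)
                 ≡ c ! u * cartan u v * (if does u≟v then 1ℤ else 0ℤ)
    diagonal u (yes _) = trans (ℤP.+-identityʳ (c ! u * cartan u v)) (sym (ℤP.*-identityʳ (c ! u * cartan u v)))
    diagonal u (no _)  = cancel (c ! u) (cartan u v)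
      where cancel : ∀ a b → a * b + (- b) * a ≡ a * b * 0ℤ
            cancel = solve-∀

  indicator-⁅⁆ : ∀ j i → indicator R ⁅ j ⁆ i ≡ δ i j
  indicator-⁅⁆ j i = cong (λ b → if b then 1ℤ else 0ℤ) (lookup-⁅⁆ j i)
    where
    lookup-⁅⁆ : ∀ {n} (j i : Fin n) → lookup ⁅ j ⁆ i ≡ does (i F.≟ j)
    lookup-⁅⁆ zero    zero    = refl
    lookup-⁅⁆ zero    (suc i) = VP.lookup-replicate i false
    lookup-⁅⁆ (suc j) zero    = refl
    lookup-⁅⁆ (suc j) (suc i) = lookup-⁅⁆ j i

  module Game (j : Fin r) where

    excess : V → Fin r → ℤ
    excess c i = ⟨ c , i ∨⟩ - δ i j

    -- The coefficients of the functional x ↦ 2 (c - ϖ, x).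
    weight : V → Fin r → ℚ
    weight c i = D i ℚ.* toℚ (excess c i)

    move-reflects : ∀ c v → c [ v ]≔ (- c ! v + nbr R c v + indicator R ⁅ j ⁆ v) ≡ c -[ excess c v ]· α v
    move-reflects c v = lookup-ext (λ i → by-cases i (i F.≟ v))
      where
      nbr≡ : ∀ i → nbr R c i ≡ + 2 * c ! i - ⟨ c , i ∨⟩
      nbr≡ i = trans (unshift (nbr R c i) ⟨ c , i ∨⟩) (cong (_- ⟨ c , i ∨⟩) (⟨,∨⟩+nbr c i))
        where unshift : ∀ n a → n ≡ a + n - a
              unshift = solve-∀
      reflect : ∀ a b d → - a + (+ 2 * a - b) + d ≡ a - (b - d) * 1ℤ
      reflect = solve-∀
      by-cases : ∀ i → Dec (i ≡ v) →
                 lookup (c [ v ]≔ (- c ! v + nbr R c v + indicator R ⁅ j ⁆ v)) i ≡ (c -[ excess c v ]· α v) ! i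
      by-cases i (yes refl) = begin
        lookup (c [ i ]≔ (- c ! i + nbr R c i + indicator R ⁅ j ⁆ i)) i
          ≡⟨ VP.lookup∘update i c _ ⟩
        - c ! i + nbr R c i + indicator R ⁅ j ⁆ i
          ≡⟨ cong₂ (λ n d → - c ! i + n + d) (nbr≡ i) (indicator-⁅⁆ j i) ⟩
        - c ! i + (+ 2 * c ! i - ⟨ c , i ∨⟩) + δ i j
          ≡⟨ reflect (c ! i) ⟨ c , i ∨⟩ (δ i j) ⟩
        c ! i - excess c i * 1ℤ
          ≡⟨ cong (λ t → c ! i - excess c i * t) (sym (trans (α-! i i) (ℤΣ.δ-refl i))) ⟩
        c ! i - excess c i * α i ! i
          ≡⟨ sym (-[]·-! c (excess c i) (α i) i) ⟩
        (c -[ excess c i ]· α i) ! i ∎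
      by-cases i (no i≢v) = begin
        lookup (c [ v ]≔ (- c ! v + nbr R c v + indicator R ⁅ j ⁆ v)) i
          ≡⟨ VP.lookup∘update′ i≢v c _ ⟩
        c ! i
          ≡⟨ sym (vanish (c ! i) (excess c v)) ⟩
        c ! i - excess c v * 0ℤ
          ≡⟨ cong (λ t → c ! i - excess c v * t) (sym (trans (α-! v i) (ℤΣ.δ-≢ i≢v))) ⟩
        c ! i - excess c v * α v ! i
          ≡⟨ sym (-[]·-! c (excess c v) (α v) i) ⟩
        (c -[ excess c v ]· α v) ! i ∎
        where vanish : ∀ a e → a - e * 0ℤ ≡ a
              vanish = solve-∀

    not-sad : ∀ c v → ¬ Sad R ⁅ j ⁆ c v → 0ℤ ≤ excess c v
    not-sad c v ¬sad = subst (0ℤ ≤_) rearranged (ℤP.i≤j⇒0≤j-i (ℤP.≮⇒≥ ¬sad))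
      where
      regroup : ∀ a n d → a + n - (n + d) ≡ a - d
      regroup = solve-∀
      rearranged : + 2 * c ! v - (nbr R c v + indicator R ⁅ j ⁆ v) ≡ excess c v
      rearranged = begin
        + 2 * c ! v - (nbr R c v + indicator R ⁅ j ⁆ v)
          ≡⟨ cong₂ (λ a d → a - (nbr R c v + d)) (sym (⟨,∨⟩+nbr c v)) (indicator-⁅⁆ j v) ⟩
        ⟨ c , v ∨⟩ + nbr R c v - (nbr R c v + δ v j)
          ≡⟨ regroup ⟨ c , v ∨⟩ (nbr R c v) (δ v j) ⟩
        excess c v ∎

    weight-reflect : ∀ c v x → ev (weight (c -[ excess c v ]· α v)) x ≡ ev (weight c) (s v x)
    weight-reflect c v x = begin
      ev (weight (c -[ e ]· α v)) x
        ≡⟨ ev-cong coefficient x ⟩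
      ev (λ i → weight c i ℚ.- toℚ e ℚ.* (D i ℚ.* toℚ ⟨ α v , i ∨⟩)) x
        ≡⟨ ev-sub-functional (weight c) (toℚ e) (λ i → D i ℚ.* toℚ ⟨ α v , i ∨⟩) x ⟩
      ev (weight c) x ℚ.- toℚ e ℚ.* ⟪ α v , x ⟫
        ≡⟨ cong (λ t → ev (weight c) x ℚ.- toℚ e ℚ.* t) (⟪α,⟫ v x) ⟩
      ev (weight c) x ℚ.- toℚ e ℚ.* (D v ℚ.* toℚ ⟨ x , v ∨⟩)
        ≡⟨ swap (ev (weight c) x) (toℚ e) (D v) (toℚ ⟨ x , v ∨⟩) ⟩
      ev (weight c) x ℚ.- toℚ ⟨ x , v ∨⟩ ℚ.* weight c v
        ≡⟨ cong (λ t → ev (weight c) x ℚ.- toℚ ⟨ x , v ∨⟩ ℚ.* t) (sym (ev-α (weight c) v)) ⟩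
      ev (weight c) x ℚ.- toℚ ⟨ x , v ∨⟩ ℚ.* ev (weight c) (α v)
        ≡⟨ sym (ev-sub (weight c) x ⟨ x , v ∨⟩ (α v)) ⟩
      ev (weight c) (s v x) ∎
      where
      e = excess c v
      swap : ∀ a e d p → a ℚ.- e ℚ.* (d ℚ.* p) ≡ a ℚ.- p ℚ.* (d ℚ.* e)
      swap = solve 4 (λ a e d p → a :- e :* (d :* p) := a :- p :* (d :* e)) refl
      distrib : ∀ d a e b → d ℚ.* (a ℚ.- e ℚ.* b) ≡ d ℚ.* a ℚ.- e ℚ.* (d ℚ.* b)
      distrib = solve 4 (λ d a e b → d :* (a :- e :* b) := d :* a :- e :* (d :* b)) refl
      regroup : ∀ a e b d → a - e * b - d ≡ a - d - e * b
      regroup = solve-∀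
      coefficient : ∀ i → weight (c -[ e ]· α v) i ≡ weight c i ℚ.- toℚ e ℚ.* (D i ℚ.* toℚ ⟨ α v , i ∨⟩)
      coefficient i = begin
        D i ℚ.* toℚ (⟨ c -[ e ]· α v , i ∨⟩ - δ i j)
          ≡⟨ cong (λ t → D i ℚ.* toℚ (t - δ i j)) (weigh-sub (λ u → cartan u i) c e (α v)) ⟩
        D i ℚ.* toℚ (⟨ c , i ∨⟩ - e * ⟨ α v , i ∨⟩ - δ i j)
          ≡⟨ cong (λ t → D i ℚ.* toℚ t) (regroup ⟨ c , i ∨⟩ e ⟨ α v , i ∨⟩ (δ i j)) ⟩
        D i ℚ.* toℚ (excess c i - e * ⟨ α v , i ∨⟩)
          ≡⟨ cong (D i ℚ.*_) (trans (toℚ-- (excess c i) (e * ⟨ α v , i ∨⟩))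
                                    (cong (λ t → toℚ (excess c i) ℚ.- t) (toℚ-* e ⟨ α v , i ∨⟩))) ⟩
        D i ℚ.* (toℚ (excess c i) ℚ.- toℚ e ℚ.* toℚ ⟨ α v , i ∨⟩)
          ≡⟨ distrib (D i) (toℚ (excess c i)) (toℚ e) (toℚ ⟨ α v , i ∨⟩) ⟩
        weight c i ℚ.- toℚ e ℚ.* (D i ℚ.* toℚ ⟨ α v , i ∨⟩) ∎

    reach : ∀ {c h} → Star (Move R ⁅ j ⁆) c h → ∃ λ u → ∀ x → ev (weight h) x ≡ ev (weight c) (act u x)
    reach ε = [] , λ x → refl
    reach {c} ((v , _ , refl) ◅ moves) =
      let (u , h≈cu) = reach moves in
      v ∷ u , λ x → trans (h≈cu x)
                          (trans (cong (λ c′ → ev (weight c′) (act u x)) (move-reflects c v))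
                                 (weight-reflect c v (act u x)))

    weight-initial : ∀ y → ev (weight (replicate r 0ℤ)) y ≡ ℚ.- (toℚ (y ! j) ℚ.* D j)
    weight-initial y = trans (ℚΣ.sum-cong-≗ term) (ℚΣ.∑-*-δ (λ i → ℚ.- (toℚ (y ! i) ℚ.* D i)) j)
      where
      ⟨0,∨⟩ : ∀ i → ⟨ replicate r 0ℤ , i ∨⟩ ≡ 0ℤ
      ⟨0,∨⟩ i = ℤΣ.∑-zero _ (λ u → trans (cong (_* cartan u i) (VP.lookup-replicate u 0ℤ))
                                         (ℤP.*-zeroˡ (cartan u i)))
      rearrange : ∀ y d t → y ℚ.* (d ℚ.* ℚ.- t) ≡ ℚ.- (y ℚ.* d) ℚ.* t
      rearrange = solve 3 (λ y d t → y :* (d :* :- t) := :- (y :* d) :* t) refl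
      term : ∀ i → toℚ (y ! i) ℚ.* weight (replicate r 0ℤ) i ≡ ℚ.- (toℚ (y ! i) ℚ.* D i) ℚ.* ℚΣ.δ i j
      term i = begin
        toℚ (y ! i) ℚ.* (D i ℚ.* toℚ (⟨ replicate r 0ℤ , i ∨⟩ - δ i j))
          ≡⟨ cong (λ t → toℚ (y ! i) ℚ.* (D i ℚ.* toℚ (t - δ i j))) (⟨0,∨⟩ i) ⟩
        toℚ (y ! i) ℚ.* (D i ℚ.* toℚ (0ℤ - δ i j))
          ≡⟨ cong (λ t → toℚ (y ! i) ℚ.* (D i ℚ.* t))
                  (trans (cong toℚ (ℤP.+-identityˡ (- δ i j))) (trans (toℚ-neg (δ i j)) (cong ℚ.-_ (toℚ-δ i j)))) ⟩
        toℚ (y ! i) ℚ.* (D i ℚ.* ℚ.- ℚΣ.δ i j)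
          ≡⟨ rearrange (toℚ (y ! i)) (D i) (ℚΣ.δ i j) ⟩
        ℚ.- (toℚ (y ! i) ℚ.* D i) ℚ.* ℚΣ.δ i j ∎

    final-excess : ∀ {h} → FinalConfig R ⁅ j ⁆ h → ∀ v → excess h v ≡ δ j (σ v)
    final-excess {h} (moves , unsad) v = toℚ-injective (*-cancelˡ-pos (D-pos v) (begin
      D v ℚ.* toℚ (excess h v)
        ≡⟨ sym (ev-α (weight h) v) ⟩
      ev (weight h) (α v)
        ≡⟨ sym (dominant-fixed h⁺ W hW⁺ (α v)) ⟩
      ev (weight h) (act W (α v))
        ≡⟨ through-w₀ (α v) ⟩
      ℚ.- (toℚ (act w₀ (α v) ! j) ℚ.* D j)
        ≡⟨ cong (λ t → ℚ.- (toℚ t ℚ.* D j)) (trans (cong (_! j) (proj₂ (w₀-simple v))) (s-α-! k j)) ⟩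
      ℚ.- (toℚ (- δ j k) ℚ.* D j)
        ≡⟨ trans (cong (λ t → ℚ.- (t ℚ.* D j)) (toℚ-neg (δ j k))) (unnegate (toℚ (δ j k)) (D j)) ⟩
      toℚ (δ j k) ℚ.* D j
        ≡⟨ trans (cong (ℚ._* D j) (toℚ-δ j k)) (trans (ℚΣ.δ-* D j k) (cong (ℚΣ.δ j k ℚ.*_) (D-σ v))) ⟩
      ℚΣ.δ j k ℚ.* D v
        ≡⟨ trans (ℚP.*-comm (ℚΣ.δ j k) (D v)) (cong (D v ℚ.*_) (sym (toℚ-δ j k))) ⟩
      D v ℚ.* toℚ (δ j k) ∎))
      where
      k = σ v
      unnegate : ∀ d x → ℚ.- (ℚ.- d ℚ.* x) ≡ d ℚ.* x
      unnegate = solve 2 (λ d x → :- (:- d :* x) := d :* x) refl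
      u = proj₁ (reach moves)
      W = reverse u ++ w₀
      through-w₀ : ∀ y → ev (weight h) (act W y) ≡ ℚ.- (toℚ (act w₀ y ! j) ℚ.* D j)
      through-w₀ y = begin
        ev (weight h) (act W y)
          ≡⟨ proj₂ (reach moves) (act W y) ⟩
        ev (weight (replicate r 0ℤ)) (act u (act W y))
          ≡⟨ cong (ev (weight (replicate r 0ℤ)) ∘ act u) (act-++ (reverse u) w₀ y) ⟩
        ev (weight (replicate r 0ℤ)) (act u (act (reverse u) (act w₀ y)))
          ≡⟨ cong (ev (weight (replicate r 0ℤ))) (act-reverse′ u (act w₀ y)) ⟩
        ev (weight (replicate r 0ℤ)) (act w₀ y)
          ≡⟨ weight-initial (act w₀ y) ⟩
        ℚ.- (toℚ (act w₀ y ! j) ℚ.* D j) ∎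
      h⁺ : Dominant (weight h)
      h⁺ i = *-nonneg (ℚP.<⇒≤ (D-pos i)) (toℚ-mono-≤ (not-sad h i (unsad i)))
      hW⁺ : Dominant (ev (weight h) ∘ act W ∘ α)
      hW⁺ i = subst (0ℚ ℚ.≤_) (sym (through-w₀ (α i)))
                (ℚP.neg-antimono-≤ (subst (toℚ (act w₀ (α i) ! j) ℚ.* D j ℚ.≤_) (ℚP.*-zeroˡ (D j))
                  (ℚP.*-monoʳ-≤-nonNeg (D j) {{ℚ.nonNegative (ℚP.<⇒≤ (D-pos j))}}
                                       (toℚ-mono-≤ (w₀-negative i j)))))

    final-pairing : ∀ {h} → FinalConfig R ⁅ j ⁆ h → ∀ v → ⟨ h , v ∨⟩ ≡ δ j (σ v) + δ v j
    final-pairing {h} final v = trans (unshift ⟨ h , v ∨⟩ (δ v j)) (cong (_+ δ v j) (final-excess final v))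
      where unshift : ∀ a d → a ≡ a - d + d
            unshift = solve-∀

  ⟨,∨⟩-injective : ∀ {x y} → (∀ v → ⟨ x , v ∨⟩ ≡ ⟨ y , v ∨⟩) → x ≡ y
  ⟨,∨⟩-injective {x} {y} x≈y = lookup-ext λ i →
    trans (shift (x ! i) (y ! i))
          (trans (cong (_+ y ! i) (trans (sym (-[]·-! x 1ℤ y i)) (nondegenerate (x -[ 1ℤ ]· y) x-y⊥ i)))
                 (ℤP.+-identityˡ (y ! i)))
    where
    shift : ∀ a b → a ≡ a - 1ℤ * b + b
    shift = solve-∀
    cancel : ∀ a → a - 1ℤ * a ≡ 0ℤ
    cancel = solve-∀
    x-y⊥ : ∀ v → ⟨ x -[ 1ℤ ]· y , v ∨⟩ ≡ 0ℤ
    x-y⊥ v = trans (weigh-sub (λ u → cartan u v) x 1ℤ y)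
                   (trans (cong (λ t → t - 1ℤ * ⟨ y , v ∨⟩) (x≈y v)) (cancel ⟨ y , v ∨⟩))

  ∑configs : (Fin r → V) → V
  ∑configs h = tabulate (λ k → Σℤ (λ j → h j ! k))

  ⟨∑final,∨⟩ : ∀ (h : Fin r → V) → (∀ j → FinalConfig R ⁅ j ⁆ (h j)) → ∀ v → ⟨ ∑configs h , v ∨⟩ ≡ + 2
  ⟨∑final,∨⟩ h final v = begin
    ⟨ ∑configs h , v ∨⟩
      ≡⟨ weigh-combination (λ u → cartan u v) ∑h ⟩
    sum (λ j → 1ℤ * ⟨ h j , v ∨⟩)
      ≡⟨ ℤΣ.sum-cong-≗ (λ j → trans (ℤP.*-identityˡ _) (Game.final-pairing j (final j) v)) ⟩
    sum (λ j → δ j (σ v) + δ v j)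
      ≡⟨ ℤΣ.∑-distrib-+ (λ j → δ j (σ v)) (λ j → δ v j) ⟩
    sum (λ j → δ j (σ v)) + sum (λ j → δ v j)
      ≡⟨ cong₂ _+_ (ℤΣ.∑-δ (σ v)) (trans (ℤΣ.sum-cong-≗ (ℤΣ.δ-sym v)) (ℤΣ.∑-δ v)) ⟩
    + 2 ∎
    where
    ∑h : IsCombination (λ _ → 1ℤ) h (∑configs h)
    ∑h = combination λ k → trans (VP.lookup∘tabulate _ k)
                                 (trans (Σℤ≡∑ (λ j → h j ! k))
                                        (ℤΣ.sum-cong-≗ (λ j → sym (ℤP.*-identityˡ (h j ! k)))))

mainTheorem7 : (R : RootSystem) (h : Fin (RootSystem.r R) → Vec ℤ (RootSystem.r R)) →
    (∀ j → FinalConfig R ⁅ j ⁆ (h j)) →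
    ∀ k → sumPositive R k ≡ Σℤ (λ j → lookup (h j) k)
mainTheorem7 R h final k = begin
  sumPositive R k               ≡⟨ sym (VP.lookup∘tabulate (sumPositive R) k) ⟩
  ∑Φ⁺ ! k                       ≡⟨ cong (_! k) (⟨,∨⟩-injective {∑Φ⁺} {∑configs h} ∑Φ⁺≈∑h) ⟩
  ∑configs h ! k                ≡⟨ VP.lookup∘tabulate (λ k → Σℤ (λ j → h j ! k)) k ⟩
  Σℤ (λ j → lookup (h j) k)     ∎
  where
  open RootSystemProperties R
  ∑Φ⁺≈∑h : ∀ v → ⟨ ∑Φ⁺ , v ∨⟩ ≡ ⟨ ∑configs h , v ∨⟩
  ∑Φ⁺≈∑h v = trans (⟨∑Φ⁺,∨⟩ v) (sym (⟨∑final,∨⟩ h final v))
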